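{- Let $q$ be a constant and let $D$ be the formal derivative associated with the context-free grammar on the alphabet $\{x,y,z,e\}$ given by $$x\rightarrow xy^2,\qquad y\rightarrow x^2y,\qquad z\rightarrow x^2y^2z^{ -3},\qquad e\rightarrow qez^4.$$ Then for $n\ge0$, $$D^n(e)=e\sum_{\pi\in\mathcal{D}_n^B}x^{2\,\mathrm{wexc}(\pi)}y^{2\,\mathrm{aexc}(\pi)}z^{4\,\mathrm{single}(\pi)}q^{\mathrm{cyc}(\pi)}.$$
   Context: The formal derivative $D$ is the unique linear derivation (Leibniz rule) on Laurent polynomials in $x,y,z,e$ with $D$ of each letter given by the grammar and $D(q)=0$. $B_n$ is the group of signed permutations $\pi$ of $\pm[n]$ with $\pi(-i)=-\pi(i)$; $\mathcal{D}_n^B$ is the set of $\pi\in B_n$ with no $i\in[n]$ satisfying $\pi(i)=i$. For $\pi\in\mathcal{D}_n^B$: $\mathrm{wexc}(\pi)=\#\{i\in[n]:\pi(|\pi(i)|)>\pi(i)\}$, $\mathrm{aexc}(\pi)=\#\{i\in[n]:\pi(|\pi(i)|)<\pi(i)\}$, $\mathrm{single}(\pi)=\#\{i\in[n]:\pi(i)=-i\}$, and $\mathrm{cyc}(\pi)$ is the number of cycles of $\pi$, i.e. the number of cycles of the permutation $i\mapsto|\pi(i)|$ of $[n]$ (a signed cycle $(c_1,\dots,c_k)$ meaning $\pi(|c_j|)=c_{j+1}$ with indices mod $k$). -}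

module Defs where

open import Data.Bool using (Bool; true; false; _∧_; _∨_; not; if_then_else_)
open import Data.Nat as ℕ using (ℕ; zero; suc)
open import Data.Integer as ℤ using (ℤ; +_; -_)
open import Data.Fin as Fin using (Fin; toℕ)
open import Data.Fin.Properties using () renaming (_≟_ to _≟ᶠ_)
open import Data.List using (List; []; _∷_; map; concatMap; allFin; cartesianProduct; filter; length; foldr)
open import Data.Bool.ListAction using (all; any)
open import Data.Vec as Vec using (Vec; lookup)
open import Data.Product using (_×_; _,_; proj₁; proj₂)
open import Relation.Nullary.Decidable using (⌊_⌋; _×-dec_)
open import Relation.Binary.PropositionalEquality using (_≡_)
open import Function using (_∘_)

-- Laurent polynomials in x, y, z, e with coefficients in ℤ[q]
-- (q is treated as a formal constant: a further variable on which D vanishes).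

record Mono : Set where
  constructor mono
  field
    ex ey ez ee : ℤ
    eq : ℕ
open Mono public

Poly : Set
Poly = List (ℤ × Mono)

_≟ᵐ_ : (m n : Mono) → Bool
mono a b c d k ≟ᵐ mono a' b' c' d' k' =
  ⌊ a ℤ.≟ a' ⌋ ∧ ⌊ b ℤ.≟ b' ⌋ ∧ ⌊ c ℤ.≟ c' ⌋ ∧ ⌊ d ℤ.≟ d' ⌋ ∧ ⌊ k ℕ.≟ k' ⌋

-- coefficient of the monomial m in p; two polynomials are equal iff all
-- coefficients agree.
coeff : Mono → Poly → ℤ
coeff m [] = + 0
coeff m ((c , n) ∷ p) = (if n ≟ᵐ m then c else + 0) ℤ.+ coeff m p

monoMul : Mono → Mono → Mono
monoMul (mono a b c d k) (mono a' b' c' d' k') =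
  mono (a ℤ.+ a') (b ℤ.+ b') (c ℤ.+ c') (d ℤ.+ d') (k ℕ.+ k')

data Letter : Set where
  lx ly lz le : Letter

expOf : Letter → Mono → ℤ
expOf lx m = ex m
expOf ly m = ey m
expOf lz m = ez m
expOf le m = ee m

divL : Letter → Mono → Mono
divL lx (mono a b c d k) = mono (a ℤ.- + 1) b c d k
divL ly (mono a b c d k) = mono a (b ℤ.- + 1) c d k
divL lz (mono a b c d k) = mono a b (c ℤ.- + 1) d k
divL le (mono a b c d k) = mono a b c (d ℤ.- + 1) k

rule : Letter → Poly
rule lx = (+ 1 , mono (+ 1) (+ 2) (+ 0) (+ 0) 0) ∷ []
rule ly = (+ 1 , mono (+ 2) (+ 1) (+ 0) (+ 0) 0) ∷ []
rule lz = (+ 1 , mono (+ 2) (+ 2) (- + 3) (+ 0) 0) ∷ []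
rule le = (+ 1 , mono (+ 0) (+ 0) (+ 4) (+ 1) 1) ∷ []

letters : List Letter
letters = lx ∷ ly ∷ lz ∷ le ∷ []

-- The formal derivative: the unique derivation with D(letter) = rule letter,
-- D q = 0.  On a term c·m it is  Σ_L c·(exp_L m)·(m/L)·D(L)
-- (Leibniz rule, valid also for negative exponents).
Dterm : ℤ × Mono → Poly
Dterm (c , m) = concatMap
  (λ L → map (λ { (c' , m') → (c ℤ.* expOf L m ℤ.* c' , monoMul (divL L m) m') }) (rule L))
  letters

D : Poly → Poly
D = concatMap Dterm

Dⁿ : ℕ → Poly → Poly
Dⁿ zero p = p
Dⁿ (suc n) p = D (Dⁿ n p)

-- Signed permutations.  An element of {±} × [n]-valued vector
-- π = (s₁,σ₁) … (sₙ,σₙ) encodes π(i+1) = ±(σᵢ + 1) (sign true = negative);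
-- it is in B_n iff i ↦ σᵢ is a bijection of Fin n.

SFun : ℕ → Set
SFun n = Vec (Bool × Fin n) n

allVecs : {A : Set} → (k : ℕ) → List A → List (Vec A k)
allVecs zero xs = Vec.[] ∷ []
allVecs (suc k) xs = concatMap (λ a → map (a Vec.∷_) (allVecs k xs)) xs

module _ {n : ℕ} (π : SFun n) where
  σ : Fin n → Fin n
  σ i = proj₂ (lookup π i)

  neg : Fin n → Bool
  neg i = proj₁ (lookup π i)

  -- value π(i) as an integer, for i ∈ [n] given as Fin n (i ↦ i+1)
  val : Fin n → ℤ
  val i = if neg i then - (+ suc (toℕ (σ i))) else + suc (toℕ (σ i))

  isBij : Bool
  isBij = all (λ i → all (λ j → not ⌊ σ i ≟ᶠ σ j ⌋ ∨ ⌊ i ≟ᶠ j ⌋) (allFin n)) (allFin n)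

  hasFixed : Bool
  hasFixed = any (λ i → not (neg i) ∧ ⌊ σ i ≟ᶠ i ⌋) (allFin n)

  count : (Fin n → Bool) → ℕ
  count P = length (filter (λ i → P i Data.Bool.≟ true) (allFin n))

  -- π(|π(i)|) = val (σ i)
  wexc : ℕ
  wexc = count (λ i → ⌊ val i ℤ.<? val (σ i) ⌋)

  aexc : ℕ
  aexc = count (λ i → ⌊ val (σ i) ℤ.<? val i ⌋)

  single : ℕ
  single = count (λ i → neg i ∧ ⌊ σ i ≟ᶠ i ⌋)

  iterσ : ℕ → Fin n → Fin n
  iterσ zero i = i
  iterσ (suc k) i = σ (iterσ k i)

  -- number of cycles of i ↦ |π(i)|: each cycle is counted once, via its
  -- least element (an orbit has at most n elements, so σ⁰…σⁿ⁻¹ cover it).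
  cyc : ℕ
  cyc = count (λ i → all (λ k → ⌊ toℕ i ℕ.≤? toℕ (iterσ (toℕ k) i) ⌋) (allFin n))

-- 𝒟ᴮₙ as an explicit list (each element exactly once)
derangementsB : (n : ℕ) → List (SFun n)
derangementsB n =
  filter (λ π → (isBij π ∧ not (hasFixed π)) Data.Bool.≟ true)
         (allVecs n (cartesianProduct (true ∷ false ∷ []) (allFin n)))

rhs : ℕ → Poly
rhs n = map (λ π → (+ 1 , mono (+ (2 ℕ.* wexc π)) (+ (2 ℕ.* aexc π))
                               (+ (4 ℕ.* single π)) (+ 1) (cyc π)))
            (derangementsB n)

ePoly : Poly
ePoly = (+ 1 , mono (+ 0) (+ 0) (+ 0) (+ 1) 0) ∷ []

module Submission where

-- Induction on n, comparing the coefficients of every monomial (polynomials are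
-- lists of terms, so equality means equality of all coefficients).
-- Algebra: D respects coefficientwise equality, and it sends the monomial
--   e x^{2w} y^{2a} z^{4s} q^c of a statistic vector v = (w, a, s, c) to
--   2w·(w, a+1, s, c) + 2a·(w+1, a, s, c) + 4s·(w+1, a+1, s−1, c) + (w, a, s+1, c+1);
--   the operator Step expresses this on weights G of statistic vectors.
-- Combinatorics: every π' ∈ 𝒟ᴮₙ₊₁ arises exactly once by inserting n+1 into some
--   π ∈ 𝒟ᴮₙ, either as the new cycle (−(n+1)) or, with a choice of signs, right
--   after an entry π(p) of the cycle notation.  Following the statistics through
--   the insertion (cycle minima by simulating orbits) gives, for every weight G,
--     Σ_{𝒟ᴮₙ₊₁} G ∘ stats = Σ_{𝒟ᴮₙ} Step G ∘ stats.

open import Defs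
open import Data.Nat using (ℕ)
open import Relation.Binary.PropositionalEquality using (_≡_)

open import Data.Bool as Bool using (Bool; true; false; _∧_; _∨_; not; if_then_else_)
open import Data.Bool.Properties using (∧-zeroʳ; ∨-zeroʳ; ∨-identityʳ)
open import Data.Bool.ListAction using (all; any)
open import Data.Nat as ℕ using (zero; suc; _+_; _*_; _∸_; _≤_; _<_; pred)
import Data.Nat.Properties as ℕP
open import Data.Integer as ℤ using (ℤ; +_; -_)
import Data.Integer.Properties as ℤP
open import Data.Fin as Fin using (Fin; toℕ; inject₁; fromℕ; fromℕ<)
import Data.Fin.Properties as FinP
open import Data.Maybe as Maybe using (Maybe; just; nothing)
import Data.Maybe.Properties as MaybeP
open import Data.List using (List; []; _∷_; _++_; map; concatMap; allFin; tabulate; cartesianProduct; filter; length)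
open import Data.Vec as Vec using (Vec; lookup)
import Data.Vec.Properties as VecP
open import Data.Product using (Σ; _×_; _,_; proj₁; proj₂)
import Data.Product.Properties as ProdP
open import Data.Sum using (_⊎_; inj₁; inj₂)
open import Data.Empty using (⊥; ⊥-elim)
open import Function using (_∘_; id; _⇔_; mk⇔)
open import Relation.Nullary using (Dec; yes; no; ¬_)
open import Relation.Nullary.Decidable using (⌊_⌋; isYes≗does; dec-true; dec-false; does-⇔; _×-dec_)
open import Relation.Binary using (DecidableEquality)
open import Relation.Binary.PropositionalEquality
open import Data.Nat.Tactic.RingSolver using (solve-∀)
import Data.Integer.Tactic.RingSolver as ℤ-Solver

module _ {P : Set} where

  ⌊⌋-true : (d : Dec P) → P → ⌊ d ⌋ ≡ true
  ⌊⌋-true d p = trans (isYes≗does d) (dec-true d p)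

  ⌊⌋-false : (d : Dec P) → ¬ P → ⌊ d ⌋ ≡ false
  ⌊⌋-false d ¬p = trans (isYes≗does d) (dec-false d ¬p)

  ⌊⌋-sound : (d : Dec P) → ⌊ d ⌋ ≡ true → P
  ⌊⌋-sound (yes p) _ = p

module _ {P Q : Set} where

  ⌊⌋-⇔ : P ⇔ Q → (d : Dec P) (d' : Dec Q) → ⌊ d ⌋ ≡ ⌊ d' ⌋
  ⌊⌋-⇔ P⇔Q d d' = trans (isYes≗does d) (trans (does-⇔ P⇔Q d d') (sym (isYes≗does d')))

  ⌊⌋-× : (d : Dec P) (d' : Dec Q) → ⌊ d ×-dec d' ⌋ ≡ ⌊ d ⌋ ∧ ⌊ d' ⌋
  ⌊⌋-× d d' = trans (isYes≗does (d ×-dec d')) (sym (cong₂ _∧_ (isYes≗does d) (isYes≗does d')))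

∧-true : ∀ {a b} → a ∧ b ≡ true → a ≡ true × b ≡ true
∧-true {true} {true} e = refl , refl

𝟙 : Bool → ℕ
𝟙 true = 1
𝟙 false = 0

𝟙-∧ : ∀ a b → 𝟙 (a ∧ b) ≡ 𝟙 a * 𝟙 b
𝟙-∧ true b = sym (ℕP.+-identityʳ (𝟙 b))
𝟙-∧ false b = refl

∑ : {A : Set} → List A → (A → ℕ) → ℕ
∑ [] f = 0
∑ (x ∷ xs) f = f x + ∑ xs f

module _ {A : Set} where

  ∑-cong : ∀ (xs : List A) {f g : A → ℕ} → (∀ x → f x ≡ g x) → ∑ xs f ≡ ∑ xs g
  ∑-cong [] e = refl
  ∑-cong (x ∷ xs) e = cong₂ _+_ (e x) (∑-cong xs e)

  ∑-zero : ∀ (xs : List A) → ∑ xs (λ _ → 0) ≡ 0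
  ∑-zero [] = refl
  ∑-zero (x ∷ xs) = ∑-zero xs

  ∑-++ : ∀ (xs ys : List A) f → ∑ (xs ++ ys) f ≡ ∑ xs f + ∑ ys f
  ∑-++ [] ys f = refl
  ∑-++ (x ∷ xs) ys f = trans (cong (_+_ (f x)) (∑-++ xs ys f)) (sym (ℕP.+-assoc (f x) _ _))

  ∑-+ : ∀ (xs : List A) f g → ∑ xs (λ x → f x + g x) ≡ ∑ xs f + ∑ xs g
  ∑-+ [] f g = refl
  ∑-+ (x ∷ xs) f g rewrite ∑-+ xs f g = shuffle (f x) (g x) (∑ xs f) (∑ xs g)
    where
    shuffle : ∀ a b c d → a + b + (c + d) ≡ a + c + (b + d)
    shuffle = solve-∀

  ∑-*ˡ : ∀ (xs : List A) k f → ∑ xs (λ x → k * f x) ≡ k * ∑ xs f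
  ∑-*ˡ [] k f = sym (ℕP.*-zeroʳ k)
  ∑-*ˡ (x ∷ xs) k f rewrite ∑-*ˡ xs k f = sym (ℕP.*-distribˡ-+ k (f x) _)

  ∑-*ʳ : ∀ (xs : List A) f k → ∑ xs (λ x → f x * k) ≡ ∑ xs f * k
  ∑-*ʳ xs f k = trans (∑-cong xs (λ x → ℕP.*-comm (f x) k)) (trans (∑-*ˡ xs k f) (ℕP.*-comm k _))

  ∑-filter : ∀ (P : A → Bool) (xs : List A) f →
    ∑ (filter (λ x → P x Bool.≟ true) xs) f ≡ ∑ xs (λ x → 𝟙 (P x) * f x)
  ∑-filter P [] f = refl
  ∑-filter P (x ∷ xs) f with P x
  ... | true = cong₂ _+_ (sym (ℕP.+-identityʳ (f x))) (∑-filter P xs f)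
  ... | false = ∑-filter P xs f

  length-filter : ∀ (P : A → Bool) (xs : List A) →
    length (filter (λ x → P x Bool.≟ true) xs) ≡ ∑ xs (𝟙 ∘ P)
  length-filter P [] = refl
  length-filter P (x ∷ xs) with P x
  ... | true = cong suc (length-filter P xs)
  ... | false = length-filter P xs

  ∑-const-on : ∀ (xs : List A) (P : A → Bool) (f : A → ℕ) K → (∀ x → P x ≡ true → f x ≡ K) →
    ∑ xs (λ x → 𝟙 (P x) * f x) ≡ ∑ xs (𝟙 ∘ P) * K
  ∑-const-on xs P f K h = trans (∑-cong xs pointwise) (∑-*ʳ xs (𝟙 ∘ P) K)
    where
    pointwise : ∀ x → 𝟙 (P x) * f x ≡ 𝟙 (P x) * K
    pointwise x with P x in eq
    ... | true = cong (1 *_) (h x eq)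
    ... | false = refl

module _ {A B : Set} where

  ∑-map : ∀ (g : A → B) (xs : List A) f → ∑ (map g xs) f ≡ ∑ xs (f ∘ g)
  ∑-map g [] f = refl
  ∑-map g (x ∷ xs) f = cong (_+_ (f (g x))) (∑-map g xs f)

  ∑-concatMap : ∀ (g : A → List B) (xs : List A) f → ∑ (concatMap g xs) f ≡ ∑ xs (λ x → ∑ (g x) f)
  ∑-concatMap g [] f = refl
  ∑-concatMap g (x ∷ xs) f =
    trans (∑-++ (g x) (concatMap g xs) f) (cong (_+_ (∑ (g x) f)) (∑-concatMap g xs f))

  ∑-swap : ∀ (xs : List A) (ys : List B) (h : A → B → ℕ) →
    ∑ xs (λ a → ∑ ys (h a)) ≡ ∑ ys (λ b → ∑ xs (λ a → h a b))
  ∑-swap [] ys h = sym (∑-zero ys)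
  ∑-swap (x ∷ xs) ys h =
    trans (cong (_+_ (∑ ys (h x))) (∑-swap xs ys h)) (sym (∑-+ ys (h x) (λ b → ∑ xs (λ a → h a b))))

∑-cartesian : ∀ {A B : Set} (xs : List A) (ys : List B) (f : A × B → ℕ) →
  ∑ (cartesianProduct xs ys) f ≡ ∑ xs (λ a → ∑ ys (λ b → f (a , b)))
∑-cartesian [] ys f = refl
∑-cartesian (x ∷ xs) ys f =
  trans (∑-++ (map (x ,_) ys) _ f) (cong₂ _+_ (∑-map (x ,_) ys f) (∑-cartesian xs ys f))

∑-tabulate : ∀ {A : Set} {n} (f : Fin n → A) g → ∑ (tabulate f) g ≡ ∑ (allFin n) (g ∘ f)
∑-tabulate {n = zero} f g = refl
∑-tabulate {n = suc n} f g =
  cong (_+_ (g (f Fin.zero))) (trans (∑-tabulate (f ∘ Fin.suc) g) (sym (∑-tabulate Fin.suc (g ∘ f))))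

∑-allFin-suc : ∀ n (g : Fin (suc n) → ℕ) → ∑ (allFin (suc n)) g ≡ g Fin.zero + ∑ (allFin n) (g ∘ Fin.suc)
∑-allFin-suc n g = cong (_+_ (g Fin.zero)) (∑-tabulate Fin.suc g)

∑-allFin-last : ∀ n (g : Fin (suc n) → ℕ) → ∑ (allFin (suc n)) g ≡ ∑ (allFin n) (g ∘ inject₁) + g (fromℕ n)
∑-allFin-last zero g = ℕP.+-comm (g Fin.zero) 0
∑-allFin-last (suc n) g = begin
  ∑ (allFin (suc (suc n))) g                                    ≡⟨ ∑-allFin-suc (suc n) g ⟩
  g Fin.zero + ∑ (allFin (suc n)) (g ∘ Fin.suc)                 ≡⟨ cong (_+_ (g Fin.zero)) (∑-allFin-last n (g ∘ Fin.suc)) ⟩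
  g Fin.zero + (∑ (allFin n) (g ∘ Fin.suc ∘ inject₁) + g (fromℕ (suc n)))
                                                                ≡⟨ sym (ℕP.+-assoc (g Fin.zero) _ _) ⟩
  g Fin.zero + ∑ (allFin n) (g ∘ Fin.suc ∘ inject₁) + g (fromℕ (suc n))
                                                                ≡⟨ cong (_+ g (fromℕ (suc n))) (sym (∑-allFin-suc n (g ∘ inject₁))) ⟩
  ∑ (allFin (suc n)) (g ∘ inject₁) + g (fromℕ (suc n))          ∎
  where open ≡-Reasoning

∑-update₁ : ∀ n (g h : Fin n → ℕ) p → (∀ i → i ≢ p → g i ≡ h i) →
  ∑ (allFin n) g + h p ≡ ∑ (allFin n) h + g p
∑-update₁ (suc n) g h Fin.zero e =
  trans (cong (_+ h Fin.zero) (∑-allFin-suc n g))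
  (trans (cong (λ t → g Fin.zero + t + h Fin.zero) (∑-cong (allFin n) (λ i → e (Fin.suc i) (λ ()))))
  (trans (rotate (g Fin.zero) (∑ (allFin n) (h ∘ Fin.suc)) (h Fin.zero))
  (cong (_+ g Fin.zero) (sym (∑-allFin-suc n h)))))
  where
  rotate : ∀ a b c → a + b + c ≡ c + b + a
  rotate = solve-∀
∑-update₁ (suc n) g h (Fin.suc p) e =
  trans (cong (_+ h (Fin.suc p)) (∑-allFin-suc n g))
  (trans (ℕP.+-assoc (g Fin.zero) _ _)
  (trans (cong₂ _+_ (e Fin.zero (λ ()))
                    (∑-update₁ n (g ∘ Fin.suc) (h ∘ Fin.suc) p (λ i ne → e (Fin.suc i) (ne ∘ FinP.suc-injective))))
  (trans (sym (ℕP.+-assoc (h Fin.zero) _ _))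
  (cong (_+ g (Fin.suc p)) (sym (∑-allFin-suc n h))))))

∑-update₂ : ∀ n (g h : Fin n → ℕ) p j → p ≢ j → (∀ i → i ≢ p → i ≢ j → g i ≡ h i) →
  ∑ (allFin n) g + h p + h j ≡ ∑ (allFin n) h + g p + g j
∑-update₂ n g h p j p≢j e = begin
  Sg + h p + h j  ≡⟨ cong (λ t → Sg + t + h j) (sym (k-at-p p refl)) ⟩
  Sg + k p + h j  ≡⟨ cong (_+ h j) (∑-update₁ n g k p g≈k) ⟩
  Sk + g p + h j  ≡⟨ exchange Sk (g p) (h j) ⟩
  Sk + h j + g p  ≡⟨ cong (_+ g p) (∑-update₁ n k h j k≈h) ⟩
  Sh + k j + g p  ≡⟨ cong (λ t → Sh + t + g p) k-at-j ⟩
  Sh + g j + g p  ≡⟨ exchange Sh (g j) (g p) ⟩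
  Sh + g p + g j  ∎
  where
  open ≡-Reasoning
  exchange : ∀ a b c → a + b + c ≡ a + c + b
  exchange = solve-∀
  k : Fin n → ℕ
  k i with i Fin.≟ p
  ... | yes _ = h i
  ... | no _ = g i
  Sg = ∑ (allFin n) g
  Sh = ∑ (allFin n) h
  Sk = ∑ (allFin n) k
  k-at-p : ∀ i → i ≡ p → k i ≡ h i
  k-at-p i i≡p with i Fin.≟ p
  ... | yes _ = refl
  ... | no i≢p = ⊥-elim (i≢p i≡p)
  g≈k : ∀ i → i ≢ p → g i ≡ k i
  g≈k i i≢p with i Fin.≟ p
  ... | yes i≡p = ⊥-elim (i≢p i≡p)
  ... | no _ = refl
  k≈h : ∀ i → i ≢ j → k i ≡ h i
  k≈h i i≢j with i Fin.≟ p
  ... | yes _ = refl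
  ... | no i≢p = e i i≢p i≢j
  k-at-j : k j ≡ g j
  k-at-j with j Fin.≟ p
  ... | yes j≡p = ⊥-elim (p≢j (sym j≡p))
  ... | no _ = refl

module Enumeration {A : Set} (_≟_ : DecidableEquality A) where

  multiplicity : List A → A → ℕ
  multiplicity xs a = ∑ xs (λ b → 𝟙 ⌊ b ≟ a ⌋)

  Exact : List A → Set
  Exact xs = ∀ a → multiplicity xs a ≡ 1

  sift : ∀ xs → Exact xs → ∀ a (g : A → ℕ) → ∑ xs (λ b → 𝟙 ⌊ a ≟ b ⌋ * g b) ≡ g a
  sift xs exact a g =
    trans (∑-cong xs pointwise) (trans (∑-*ˡ xs (g a) _) (trans (cong (g a *_) (exact a)) (ℕP.*-identityʳ (g a))))
    where
    pointwise : ∀ b → 𝟙 ⌊ a ≟ b ⌋ * g b ≡ g a * 𝟙 ⌊ b ≟ a ⌋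
    pointwise b with b ≟ a
    ... | yes refl rewrite ⌊⌋-true (b ≟ b) refl = ℕP.*-comm 1 (g b)
    ... | no b≢a rewrite ⌊⌋-false (a ≟ b) (b≢a ∘ sym) = sym (ℕP.*-zeroʳ (g a))

open Enumeration using (Exact; multiplicity; sift)

module _ {A B : Set} (_≟A_ : DecidableEquality A) (_≟B_ : DecidableEquality B)
         (la : List A) (lb : List B) (exact-la : Exact _≟A_ la) (exact-lb : Exact _≟B_ lb)
         (P : A → Bool) (Q : B → Bool) (f : A → B)
         (maps-to : ∀ a → P a ≡ true → Q (f a) ≡ true)
         (injective : ∀ a a' → P a ≡ true → P a' ≡ true → f a ≡ f a' → a ≡ a')
         (surjective : ∀ b → Q b ≡ true → Σ A λ a → P a ≡ true × f a ≡ b) where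

  fibre : ∀ b → ∑ la (λ a → 𝟙 (P a) * 𝟙 ⌊ f a ≟B b ⌋) ≡ 𝟙 (Q b)
  fibre b with Q b in Qb
  ... | true = trans (∑-cong la pointwise) (exact-la a₀)
    where
    a₀ = proj₁ (surjective b Qb)
    Pa₀ = proj₁ (proj₂ (surjective b Qb))
    fa₀ = proj₂ (proj₂ (surjective b Qb))
    pointwise : ∀ a → 𝟙 (P a) * 𝟙 ⌊ f a ≟B b ⌋ ≡ 𝟙 ⌊ a ≟A a₀ ⌋
    pointwise a with P a in Pa
    ... | true = trans (ℕP.+-identityʳ _) (cong 𝟙 (⌊⌋-⇔ (mk⇔ (λ e → injective a a₀ Pa Pa₀ (trans e (sym fa₀)))
                                                        (λ { refl → fa₀ })) (f a ≟B b) (a ≟A a₀)))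
    ... | false = sym (cong 𝟙 (⌊⌋-false (a ≟A a₀) λ { refl → true≢false (trans (sym Pa₀) Pa) }))
      where
      true≢false : true ≢ false
      true≢false ()
  ... | false = trans (∑-cong la pointwise) (∑-zero la)
    where
    pointwise : ∀ a → 𝟙 (P a) * 𝟙 ⌊ f a ≟B b ⌋ ≡ 0
    pointwise a with P a in Pa
    ... | false = refl
    ... | true = trans (ℕP.+-identityʳ _)
                   (cong 𝟙 (⌊⌋-false (f a ≟B b) λ { refl → false≢true (trans (sym Qb) (maps-to a Pa)) }))
      where
      false≢true : false ≢ true
      false≢true ()

  reindex : ∀ (G : B → ℕ) → ∑ lb (λ b → 𝟙 (Q b) * G b) ≡ ∑ la (λ a → 𝟙 (P a) * G (f a))
  reindex G = begin
    ∑ lb (λ b → 𝟙 (Q b) * G b)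
      ≡⟨ ∑-cong lb (λ b → cong (_* G b) (sym (fibre b))) ⟩
    ∑ lb (λ b → ∑ la (λ a → 𝟙 (P a) * 𝟙 ⌊ f a ≟B b ⌋) * G b)
      ≡⟨ ∑-cong lb (λ b → sym (∑-*ʳ la _ (G b))) ⟩
    ∑ lb (λ b → ∑ la (λ a → 𝟙 (P a) * 𝟙 ⌊ f a ≟B b ⌋ * G b))
      ≡⟨ ∑-swap lb la _ ⟩
    ∑ la (λ a → ∑ lb (λ b → 𝟙 (P a) * 𝟙 ⌊ f a ≟B b ⌋ * G b))
      ≡⟨ ∑-cong la (λ a → trans (∑-cong lb (λ b → ℕP.*-assoc (𝟙 (P a)) _ (G b))) (∑-*ˡ lb (𝟙 (P a)) _)) ⟩
    ∑ la (λ a → 𝟙 (P a) * ∑ lb (λ b → 𝟙 ⌊ f a ≟B b ⌋ * G b))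
      ≡⟨ ∑-cong la (λ a → cong (𝟙 (P a) *_) (sift _≟B_ lb exact-lb (f a) G)) ⟩
    ∑ la (λ a → 𝟙 (P a) * G (f a))  ∎
    where open ≡-Reasoning

exact-allFin : ∀ n → Exact (Fin._≟_ {n}) (allFin n)
exact-allFin (suc n) Fin.zero =
  trans (∑-allFin-suc n (λ b → 𝟙 ⌊ b Fin.≟ Fin.zero ⌋))
        (cong suc (trans (∑-cong (allFin n) (λ b → cong 𝟙 (⌊⌋-false (Fin.suc b Fin.≟ Fin.zero) λ ())))
                         (∑-zero (allFin n))))
exact-allFin (suc n) (Fin.suc a) =
  trans (∑-allFin-suc n (λ b → 𝟙 ⌊ b Fin.≟ Fin.suc a ⌋))
        (trans (∑-cong (allFin n) (λ b → cong 𝟙 (⌊⌋-⇔ (mk⇔ FinP.suc-injective (cong Fin.suc))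
                                                        (Fin.suc b Fin.≟ Fin.suc a) (b Fin.≟ a))))
               (exact-allFin n a))

bools : List Bool
bools = true ∷ false ∷ []

exact-bools : Exact Bool._≟_ bools
exact-bools true = refl
exact-bools false = refl

𝟙-pair : ∀ {A B : Set} {a a' : A} {b b' : B} (d : Dec ((a , b) ≡ (a' , b'))) (da : Dec (a ≡ a')) (db : Dec (b ≡ b')) →
  𝟙 ⌊ d ⌋ ≡ 𝟙 ⌊ da ⌋ * 𝟙 ⌊ db ⌋
𝟙-pair d da db =
  trans (cong 𝟙 (⌊⌋-⇔ (mk⇔ (λ { refl → refl , refl }) (λ { (refl , refl) → refl })) d (da ×-dec db)))
        (trans (cong 𝟙 (⌊⌋-× da db)) (𝟙-∧ ⌊ da ⌋ ⌊ db ⌋))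

exact-pairs : ∀ {A B : Set} (da : DecidableEquality A) (db : DecidableEquality B) (xs : List A) (ys : List B) →
  Exact da xs → Exact db ys → ∀ a₀ b₀ → ∑ xs (λ a → 𝟙 ⌊ da a a₀ ⌋ * ∑ ys (λ b → 𝟙 ⌊ db b b₀ ⌋)) ≡ 1
exact-pairs da db xs ys ex ey a₀ b₀ =
  trans (∑-cong xs (λ a → trans (cong (𝟙 ⌊ da a a₀ ⌋ *_) (ey b₀)) (ℕP.*-identityʳ _))) (ex a₀)

exact-× : ∀ {A B : Set} (da : DecidableEquality A) (db : DecidableEquality B) (xs : List A) (ys : List B) →
  Exact da xs → Exact db ys → Exact (ProdP.≡-dec da db) (cartesianProduct xs ys)
exact-× da db xs ys ex ey (a₀ , b₀) =
  trans (∑-cartesian xs ys _)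
  (trans (∑-cong xs (λ a → trans (∑-cong ys (λ b → 𝟙-pair (ProdP.≡-dec da db (a , b) (a₀ , b₀)) (da a a₀) (db b b₀)))
                                 (∑-*ˡ ys (𝟙 ⌊ da a a₀ ⌋) (λ b → 𝟙 ⌊ db b b₀ ⌋))))
  (exact-pairs da db xs ys ex ey a₀ b₀))

exact-allVecs : ∀ {A : Set} (d : DecidableEquality A) (xs : List A) → Exact d xs →
  ∀ k → Exact (VecP.≡-dec {n = k} d) (allVecs k xs)
exact-allVecs d xs ex zero Vec.[] = refl
exact-allVecs d xs ex (suc k) (a₀ Vec.∷ v₀) =
  trans (∑-concatMap _ xs _)
  (trans (∑-cong xs (λ a → trans (∑-map (a Vec.∷_) (allVecs k xs) _)
                         (trans (∑-cong (allVecs k xs) (λ v → cons-indicator a v))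
                                (∑-*ˡ (allVecs k xs) (𝟙 ⌊ d a a₀ ⌋) (λ v → 𝟙 ⌊ VecP.≡-dec d v v₀ ⌋)))))
  (exact-pairs d (VecP.≡-dec d) xs (allVecs k xs) ex (exact-allVecs d xs ex k) a₀ v₀))
  where
  cons-indicator : ∀ a v → 𝟙 (⌊ VecP.≡-dec d (a Vec.∷ v) (a₀ Vec.∷ v₀) ⌋) ≡ 𝟙 ⌊ d a a₀ ⌋ * 𝟙 ⌊ VecP.≡-dec d v v₀ ⌋
  cons-indicator a v =
    trans (cong 𝟙 (⌊⌋-⇔ (mk⇔ (λ { refl → refl , refl }) (λ { (refl , refl) → refl }))
                          (VecP.≡-dec d (a Vec.∷ v) (a₀ Vec.∷ v₀)) (d a a₀ ×-dec VecP.≡-dec d v v₀)))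
          (trans (cong 𝟙 (⌊⌋-× (d a a₀) (VecP.≡-dec d v v₀))) (𝟙-∧ ⌊ d a a₀ ⌋ ⌊ VecP.≡-dec d v v₀ ⌋))

exact-maybe : ∀ {A : Set} (d : DecidableEquality A) (xs : List A) → Exact d xs →
  Exact (MaybeP.≡-dec d) (nothing ∷ map just xs)
exact-maybe d xs ex nothing = cong suc (trans (∑-map just xs _) (∑-zero xs))
exact-maybe d xs ex (just a) =
  trans (∑-map just xs _)
        (trans (∑-cong xs (λ b → cong 𝟙 (⌊⌋-⇔ (mk⇔ MaybeP.just-injective (cong just)) (MaybeP.≡-dec d (just b) (just a)) (d b a))))
               (ex a))

mono-cong : ∀ {a a' b b' c c' d d' k k'} → a ≡ a' → b ≡ b' → c ≡ c' → d ≡ d' → k ≡ k' →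
  mono a b c d k ≡ mono a' b' c' d' k'
mono-cong refl refl refl refl refl = refl

≟ᵐ-refl : ∀ m → (m ≟ᵐ m) ≡ true
≟ᵐ-refl (mono a b c d k) =
  cong₂ _∧_ (⌊⌋-true (a ℤ.≟ a) refl) (cong₂ _∧_ (⌊⌋-true (b ℤ.≟ b) refl) (cong₂ _∧_ (⌊⌋-true (c ℤ.≟ c) refl)
  (cong₂ _∧_ (⌊⌋-true (d ℤ.≟ d) refl) (⌊⌋-true (k ℕ.≟ k) refl))))

≟ᵐ-sound : ∀ m n → (m ≟ᵐ n) ≡ true → m ≡ n
≟ᵐ-sound (mono a b c d k) (mono a' b' c' d' k') e =
  let (ea , e₁) = ∧-true e ; (eb , e₂) = ∧-true e₁ ; (ec , e₃) = ∧-true e₂ ; (ed , ek) = ∧-true e₃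
  in mono-cong (⌊⌋-sound (a ℤ.≟ a') ea) (⌊⌋-sound (b ℤ.≟ b') eb) (⌊⌋-sound (c ℤ.≟ c') ec)
               (⌊⌋-sound (d ℤ.≟ d') ed) (⌊⌋-sound (k ℕ.≟ k') ek)

≟ᵐ-false : ∀ m n → m ≢ n → (m ≟ᵐ n) ≡ false
≟ᵐ-false m n m≢n with m ≟ᵐ n in eq
... | true = ⊥-elim (m≢n (≟ᵐ-sound m n eq))
... | false = refl

≟ᵐ-false⇒≢ : ∀ m n → (m ≟ᵐ n) ≡ false → m ≢ n
≟ᵐ-false⇒≢ m .m e refl with () ← trans (sym e) (≟ᵐ-refl m)

-- Each grammar rule L → rule L has a single monomial ruleMono L, and the Leibniz
-- rule turns the monomial m into expOf L m · m · δ L, with δ L = ruleMono L / L.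
ruleMono : Letter → Mono
ruleMono lx = mono (+ 1) (+ 2) (+ 0) (+ 0) 0
ruleMono ly = mono (+ 2) (+ 1) (+ 0) (+ 0) 0
ruleMono lz = mono (+ 2) (+ 2) (- + 3) (+ 0) 0
ruleMono le = mono (+ 0) (+ 0) (+ 4) (+ 1) 1

δ : Letter → Mono
δ lx = mono (+ 0) (+ 2) (+ 0) (+ 0) 0
δ ly = mono (+ 2) (+ 0) (+ 0) (+ 0) 0
δ lz = mono (+ 2) (+ 2) (- + 4) (+ 0) 0
δ le = mono (+ 0) (+ 0) (+ 4) (+ 0) 1

divL-rule : ∀ L m → monoMul (divL L m) (ruleMono L) ≡ monoMul m (δ L)
divL-rule lx (mono a b c d k) = cong (λ t → mono t _ _ _ _) (ℤP.+-assoc a (- + 1) (+ 1))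
divL-rule ly (mono a b c d k) = cong (λ t → mono _ t _ _ _) (ℤP.+-assoc b (- + 1) (+ 1))
divL-rule lz (mono a b c d k) = cong (λ t → mono _ _ t _ _) (ℤP.+-assoc c (- + 1) (- + 3))
divL-rule le (mono a b c d k) = cong (λ t → mono _ _ _ t _) (ℤP.+-assoc d (- + 1) (+ 1))

mul-injective : ∀ d m m' → monoMul m d ≡ monoMul m' d → m ≡ m'
mul-injective (mono x y z w j) (mono a b c e k) (mono a' b' c' e' k') eq =
  mono-cong (cancel x (cong ex eq)) (cancel y (cong ey eq)) (cancel z (cong ez eq)) (cancel w (cong ee eq))
            (ℕP.+-cancelʳ-≡ j k k' (cong Mono.eq eq))
  where
  cancel : ∀ x {u v} → u ℤ.+ x ≡ v ℤ.+ x → u ≡ v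
  cancel x {u} {v} e = trans (sym (undo u)) (trans (cong (λ u → u ℤ.+ (- x)) e) (undo v))
    where
    undo : ∀ t → t ℤ.+ x ℤ.+ (- x) ≡ t
    undo t = trans (ℤP.+-assoc t x (- x)) (trans (cong (ℤ._+_ t) (ℤP.+-inverseʳ x)) (ℤP.+-identityʳ t))

divisible? : ∀ d m → Dec (Σ Mono λ s → monoMul s d ≡ m)
divisible? (mono x y z w j) (mono a b c e k) with j ℕ.≤? k
... | yes j≤k = yes (mono (a ℤ.- x) (b ℤ.- y) (c ℤ.- z) (e ℤ.- w) (k ∸ j) ,
                     mono-cong (undo a x) (undo b y) (undo c z) (undo e w) (ℕP.m∸n+n≡m j≤k))
  where
  undo : ∀ t x → t ℤ.- x ℤ.+ x ≡ t
  undo t x = trans (ℤP.+-assoc t (- x) x) (trans (cong (ℤ._+_ t) (ℤP.+-inverseˡ x)) (ℤP.+-identityʳ t))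
... | no j≰k = no λ { (mono _ _ _ _ k' , eq) →
                        j≰k (subst (j ℕ.≤_) (trans (ℕP.+-comm j k') (cong Mono.eq eq)) (ℕP.m≤m+n j k')) }

termL : Letter → ℤ → Mono → Mono → ℤ
termL L c n m = if monoMul (divL L n) (ruleMono L) ≟ᵐ m then c ℤ.* expOf L n ℤ.* + 1 else + 0

termL-shape : ∀ L c n m → termL L c n m ≡ (if monoMul n (δ L) ≟ᵐ m then expOf L n ℤ.* c else + 0)
termL-shape L c n m =
  trans (cong (λ t → if t ≟ᵐ m then c ℤ.* expOf L n ℤ.* + 1 else + 0) (divL-rule L n)) (choose (monoMul n (δ L) ≟ᵐ m))
  where
  reorder : ∀ c e → c ℤ.* e ℤ.* + 1 ≡ e ℤ.* c
  reorder = ℤ-Solver.solve-∀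
  choose : ∀ b → (if b then c ℤ.* expOf L n ℤ.* + 1 else + 0) ≡ (if b then expOf L n ℤ.* c else + 0)
  choose true = reorder c (expOf L n)
  choose false = refl

coeff-Dterm : ∀ c n m → coeff m (Dterm (c , n)) ≡
  termL lx c n m ℤ.+ (termL ly c n m ℤ.+ (termL lz c n m ℤ.+ (termL le c n m ℤ.+ + 0)))
coeff-Dterm c n m = refl

coeff-++ : ∀ m (p q : Poly) → coeff m (p ++ q) ≡ coeff m p ℤ.+ coeff m q
coeff-++ m [] q = sym (ℤP.+-identityˡ _)
coeff-++ m ((c , n) ∷ p) q =
  trans (cong (ℤ._+_ (if n ≟ᵐ m then c else + 0)) (coeff-++ m p q)) (sym (ℤP.+-assoc (if n ≟ᵐ m then c else + 0) (coeff m p) (coeff m q)))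

letterCoeff : Letter → Mono → Poly → ℤ
letterCoeff L m [] = + 0
letterCoeff L m ((c , n) ∷ p) = termL L c n m ℤ.+ letterCoeff L m p

coeff-D : ∀ m P → coeff m (D P) ≡ letterCoeff lx m P ℤ.+ (letterCoeff ly m P ℤ.+ (letterCoeff lz m P ℤ.+ letterCoeff le m P))
coeff-D m [] = refl
coeff-D m ((c , n) ∷ P) =
  trans (coeff-++ m (Dterm (c , n)) (D P))
  (trans (cong (ℤ._+_ (coeff m (Dterm (c , n)))) (coeff-D m P))
         (regroup (termL lx c n m) (termL ly c n m) (termL lz c n m) (termL le c n m)
                  (letterCoeff lx m P) (letterCoeff ly m P) (letterCoeff lz m P) (letterCoeff le m P)))
  where
  regroup : ∀ a b c d A B C D → (a ℤ.+ (b ℤ.+ (c ℤ.+ (d ℤ.+ + 0)))) ℤ.+ (A ℤ.+ (B ℤ.+ (C ℤ.+ D)))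
                              ≡ (a ℤ.+ A) ℤ.+ ((b ℤ.+ B) ℤ.+ ((c ℤ.+ C) ℤ.+ (d ℤ.+ D)))
  regroup = ℤ-Solver.solve-∀

letterCoeff-source : ∀ L m s P → monoMul s (δ L) ≡ m → letterCoeff L m P ≡ expOf L s ℤ.* coeff s P
letterCoeff-source L m s [] e = sym (ℤP.*-zeroʳ (expOf L s))
letterCoeff-source L m s ((c , n) ∷ P) e =
  trans (cong₂ ℤ._+_ (trans (termL-shape L c n m) term) (letterCoeff-source L m s P e))
        (sym (ℤP.*-distribˡ-+ (expOf L s) _ _))
  where
  term : (if monoMul n (δ L) ≟ᵐ m then expOf L n ℤ.* c else + 0) ≡ expOf L s ℤ.* (if n ≟ᵐ s then c else + 0)
  term with n ≟ᵐ s in n≟s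
  ... | true with ≟ᵐ-sound n s n≟s
  ... | refl = cong (λ b → if b then expOf L n ℤ.* c else + 0) (trans (cong (_≟ᵐ m) e) (≟ᵐ-refl m))
  term | false = trans (cong (λ b → if b then expOf L n ℤ.* c else + 0)
                             (≟ᵐ-false (monoMul n (δ L)) m (λ e' → ≟ᵐ-false⇒≢ n s n≟s (mul-injective (δ L) n s (trans e' (sym e))))))
                       (sym (ℤP.*-zeroʳ (expOf L s)))

letterCoeff-none : ∀ L m P → ¬ (Σ Mono λ s → monoMul s (δ L) ≡ m) → letterCoeff L m P ≡ + 0
letterCoeff-none L m [] none = refl
letterCoeff-none L m ((c , n) ∷ P) none
  rewrite termL-shape L c n m | ≟ᵐ-false (monoMul n (δ L)) m (λ e → none (n , e))
  = trans (ℤP.+-identityˡ _) (letterCoeff-none L m P none)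

D-respects-coeff : ∀ P Q → (∀ m → coeff m P ≡ coeff m Q) → ∀ m → coeff m (D P) ≡ coeff m (D Q)
D-respects-coeff P Q P≈Q m =
  trans (coeff-D m P)
  (trans (cong₂ ℤ._+_ (letter lx) (cong₂ ℤ._+_ (letter ly) (cong₂ ℤ._+_ (letter lz) (letter le))))
         (sym (coeff-D m Q)))
  where
  letter : ∀ L → letterCoeff L m P ≡ letterCoeff L m Q
  letter L with divisible? (δ L) m
  ... | yes (s , e) = trans (letterCoeff-source L m s P e)
                       (trans (cong (ℤ._*_ (expOf L s)) (P≈Q s)) (sym (letterCoeff-source L m s Q e)))
  ... | no none = trans (letterCoeff-none L m P none) (sym (letterCoeff-none L m Q none))

Stats : Set
Stats = ℕ × ℕ × ℕ × ℕ

statMono : Stats → Mono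
statMono (w , a , s , c) = mono (+ (2 * w)) (+ (2 * a)) (+ (4 * s)) (+ 1) c

-- D read off on statistics: D(x^{2w} y^{2a} z^{4s} e q^c) is
--   2w·[a+1] + 2a·[w+1] + 4s·[w+1, a+1, s−1] + [s+1, c+1].
Step : (Stats → ℕ) → Stats → ℕ
Step G (w , a , s , c) =
  2 * w * G (w , suc a , s , c) + (2 * a * G (suc w , a , s , c) +
  (4 * s * G (suc w , suc a , pred s , c) + G (w , a , suc s , suc c)))

hits : Mono → Stats → ℕ
hits m v = 𝟙 (statMono v ≟ᵐ m)

unit-termL : ∀ L M v k m → monoMul M (δ L) ≡ statMono v → expOf L M ≡ + k →
  termL L (+ 1) M m ≡ + (k * hits m v)
unit-termL L M v k m eM ek =
  trans (termL-shape L (+ 1) M m) (subst₂ (λ N e → (if N ≟ᵐ m then e ℤ.* + 1 else + 0) ≡ + (k * hits m v))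
                                            (sym eM) (sym ek) (choose (statMono v ≟ᵐ m)))
  where
  choose : ∀ b → (if b then + k ℤ.* + 1 else + 0) ≡ + (k * 𝟙 b)
  choose true = trans (ℤP.*-identityʳ (+ k)) (cong +_ (sym (ℕP.*-identityʳ k)))
  choose false = cong +_ (sym (ℕP.*-zeroʳ k))

coeff-D-statMono : ∀ v m → coeff m (Dterm (+ 1 , statMono v)) ≡ + Step (hits m) v
coeff-D-statMono (w , a , s , c) m =
  trans (coeff-Dterm (+ 1) M m)
        (cong₂ ℤ._+_ x-part (cong₂ ℤ._+_ y-part (cong₂ ℤ._+_ (z-part s) (trans (ℤP.+-identityʳ _) e-part))))
  where
  M = statMono (w , a , s , c)
  twice-suc : ∀ a → 2 * a + 2 ≡ 2 * suc a
  twice-suc = solve-∀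
  four-suc : ∀ s → 4 * s + 4 ≡ 4 * suc s
  four-suc = solve-∀
  x-part = unit-termL lx M (w , suc a , s , c) (2 * w) m
             (mono-cong (ℤP.+-identityʳ _) (cong +_ (twice-suc a)) (ℤP.+-identityʳ _) refl (ℕP.+-identityʳ c)) refl
  y-part = unit-termL ly M (suc w , a , s , c) (2 * a) m
             (mono-cong (cong +_ (twice-suc w)) (ℤP.+-identityʳ _) (ℤP.+-identityʳ _) refl (ℕP.+-identityʳ c)) refl
  -- the z-summand vanishes when there is no z, i.e. s = 0
  z-part : ∀ s → termL lz (+ 1) (statMono (w , a , s , c)) m ≡ + (4 * s * hits m (suc w , suc a , pred s , c))
  z-part zero = trans (termL-shape lz (+ 1) (statMono (w , a , 0 , c)) m) (choose (monoMul (statMono (w , a , 0 , c)) (δ lz) ≟ᵐ m))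
    where
    choose : ∀ b → (if b then + 0 ℤ.* + 1 else + 0) ≡ + 0
    choose true = refl
    choose false = refl
  z-part (suc s') = unit-termL lz (statMono (w , a , suc s' , c)) (suc w , suc a , s' , c) (4 * suc s') m
             (mono-cong (cong +_ (twice-suc w)) (cong +_ (twice-suc a)) (cong (λ t → + t ℤ.+ - + 4) (ℕP.*-suc 4 s'))
                        refl (ℕP.+-identityʳ c)) refl
  e-part = trans (unit-termL le M (w , a , suc s , suc c) 1 m
             (mono-cong (ℤP.+-identityʳ _) (ℤP.+-identityʳ _) (cong +_ (four-suc s)) refl (ℕP.+-comm c 1)) refl)
             (cong +_ (ℕP.*-identityˡ _))

coeff-units : ∀ {X : Set} (L : List X) (M : X → Mono) m →
  coeff m (map (λ x → (+ 1 , M x)) L) ≡ + ∑ L (λ x → 𝟙 (M x ≟ᵐ m))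
coeff-units [] M m = refl
coeff-units (x ∷ L) M m with M x ≟ᵐ m
... | true = cong (ℤ._+_ (+ 1)) (coeff-units L M m)
... | false = trans (ℤP.+-identityˡ _) (coeff-units L M m)

coeff-D-units : ∀ {X : Set} (L : List X) (M : X → Mono) m (h : X → ℕ) →
  (∀ x → coeff m (Dterm (+ 1 , M x)) ≡ + h x) → coeff m (D (map (λ x → (+ 1 , M x)) L)) ≡ + ∑ L h
coeff-D-units [] M m h e = refl
coeff-D-units (x ∷ L) M m h e =
  trans (coeff-++ m (Dterm (+ 1 , M x)) (D (map (λ x → (+ 1 , M x)) L))) (cong₂ ℤ._+_ (e x) (coeff-D-units L M m h e))

module _ {A : Set} where

  all-tabulate⁻ : ∀ {n} (f : Fin n → A) (p : A → Bool) → all p (tabulate f) ≡ true → ∀ i → p (f i) ≡ true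
  all-tabulate⁻ {suc n} f p e Fin.zero = proj₁ (∧-true e)
  all-tabulate⁻ {suc n} f p e (Fin.suc i) = all-tabulate⁻ (f ∘ Fin.suc) p (proj₂ (∧-true {p (f Fin.zero)} e)) i

  all-tabulate⁺ : ∀ {n} (f : Fin n → A) (p : A → Bool) → (∀ i → p (f i) ≡ true) → all p (tabulate f) ≡ true
  all-tabulate⁺ {zero} f p h = refl
  all-tabulate⁺ {suc n} f p h = cong₂ _∧_ (h Fin.zero) (all-tabulate⁺ (f ∘ Fin.suc) p (h ∘ Fin.suc))

  all-cong : ∀ (xs : List A) {p q : A → Bool} → (∀ x → p x ≡ q x) → all p xs ≡ all q xs
  all-cong [] e = refl
  all-cong (x ∷ xs) e = cong₂ _∧_ (e x) (all-cong xs e)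

  any-tabulate⁻ : ∀ {n} (f : Fin n → A) (p : A → Bool) → any p (tabulate f) ≡ false → ∀ i → p (f i) ≡ false
  any-tabulate⁻ {suc n} f p e Fin.zero with p (f Fin.zero) | e
  ... | false | _ = refl
  any-tabulate⁻ {suc n} f p e (Fin.suc i) with p (f Fin.zero) | e
  ... | false | e' = any-tabulate⁻ (f ∘ Fin.suc) p e' i

  any-tabulate⁺ : ∀ {n} (f : Fin n → A) (p : A → Bool) → (∀ i → p (f i) ≡ false) → any p (tabulate f) ≡ false
  any-tabulate⁺ {zero} f p h = refl
  any-tabulate⁺ {suc n} f p h = cong₂ Bool._∨_ (h Fin.zero) (any-tabulate⁺ (f ∘ Fin.suc) p (h ∘ Fin.suc))

-- Signed permutations as functions: i ↦ (negative?, |π(i)| − 1).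
Signed : ℕ → Set
Signed n = Bool × Fin n

SignedFun : ℕ → Set
SignedFun n = Fin n → Signed n

value : ∀ {n} → Signed n → ℤ
value e = if proj₁ e then - (+ suc (toℕ (proj₂ e))) else + suc (toℕ (proj₂ e))

perm : ∀ {n} → SignedFun n → Fin n → Fin n
perm φ i = proj₂ (φ i)

negative : ∀ {n} → SignedFun n → Fin n → Bool
negative φ i = proj₁ (φ i)

iterate : ∀ {n} → (Fin n → Fin n) → ℕ → Fin n → Fin n
iterate f zero i = i
iterate f (suc k) i = f (iterate f k i)

_≺_ : ∀ {n} → Signed n → Signed n → Bool
u ≺ v = ⌊ value u ℤ.<? value v ⌋

isOrbitMin : ∀ {n} → (Fin n → Fin n) → Fin n → Bool
isOrbitMin {n} f i = all (λ k → ⌊ toℕ i ℕ.≤? toℕ (iterate f (toℕ k) i) ⌋) (allFin n)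

ascentAt descentAt singleAt cycleMinAt : ∀ {n} → SignedFun n → Fin n → Bool
ascentAt φ i = φ i ≺ φ (perm φ i)
descentAt φ i = φ (perm φ i) ≺ φ i
singleAt φ i = negative φ i ∧ ⌊ perm φ i Fin.≟ i ⌋
cycleMinAt φ = isOrbitMin (perm φ)

card : ∀ n → (Fin n → Bool) → ℕ
card n P = ∑ (allFin n) (𝟙 ∘ P)

wexcF aexcF singleF cycF : ∀ {n} → SignedFun n → ℕ
wexcF {n} φ = card n (ascentAt φ)
aexcF {n} φ = card n (descentAt φ)
singleF {n} φ = card n (singleAt φ)
cycF {n} φ = card n (cycleMinAt φ)

statsF : ∀ {n} → SignedFun n → Stats
statsF φ = wexcF φ , aexcF φ , singleF φ , cycF φ

stats : ∀ {n} → SFun n → Stats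
stats π = wexc π , aexc π , single π , cyc π

stats-lookup : ∀ {n} (π : SFun n) → stats π ≡ statsF (lookup π)
stats-lookup {n} π =
  cong₂ _,_ (length-filter _ (allFin n)) (cong₂ _,_ (length-filter _ (allFin n))
  (cong₂ _,_ (length-filter _ (allFin n)) (trans (length-filter _ (allFin n)) (∑-cong (allFin n) cycleMin-lookup))))
  where
  iterate-lookup : ∀ k i → iterσ π k i ≡ iterate (perm (lookup π)) k i
  iterate-lookup zero i = refl
  iterate-lookup (suc k) i = cong (σ π) (iterate-lookup k i)
  cycleMin-lookup : ∀ i → 𝟙 (all (λ k → ⌊ toℕ i ℕ.≤? toℕ (iterσ π (toℕ k) i) ⌋) (allFin n)) ≡ 𝟙 (cycleMinAt (lookup π) i)
  cycleMin-lookup i = cong 𝟙 (all-cong (allFin n) (λ k → cong (λ t → ⌊ toℕ i ℕ.≤? toℕ t ⌋) (iterate-lookup (toℕ k) i)))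

Injective : ∀ {n} → (Fin n → Fin n) → Set
Injective f = ∀ i j → f i ≡ f j → i ≡ j

NoFixedPoint : ∀ {n} → SignedFun n → Set
NoFixedPoint φ = ∀ i → negative φ i ≡ false → perm φ i ≢ i

IsDerangement : ∀ {n} → SignedFun n → Set
IsDerangement φ = Injective (perm φ) × NoFixedPoint φ

isDerangement : ∀ {n} → SFun n → Bool
isDerangement π = isBij π ∧ not (hasFixed π)

isDerangement-sound : ∀ {n} (π : SFun n) → isDerangement π ≡ true → IsDerangement (lookup π)
isDerangement-sound {n} π e = injective , no-fixed-point
  where
  injective : Injective (perm (lookup π))
  injective i j σi≡σj = ⌊⌋-sound (i Fin.≟ j) (subst (λ b → (not b ∨ ⌊ i Fin.≟ j ⌋) ≡ true) (⌊⌋-true (σ π i Fin.≟ σ π j) σi≡σj)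
                           (all-tabulate⁻ id _ (all-tabulate⁻ id _ (proj₁ (∧-true e)) i) j))
  no-hasFixed : hasFixed π ≡ false
  no-hasFixed = not-true (proj₂ (∧-true {isBij π} e))
    where
    not-true : ∀ {b} → not b ≡ true → b ≡ false
    not-true {false} _ = refl
  no-fixed-point : NoFixedPoint (lookup π)
  no-fixed-point i positive fixed
    with () ← trans (sym (any-tabulate⁻ id (λ i → not (neg π i) ∧ ⌊ σ π i Fin.≟ i ⌋) no-hasFixed i))
                    (cong₂ (λ b c → not b ∧ c) positive (⌊⌋-true (σ π i Fin.≟ i) fixed))

isDerangement-complete : ∀ {n} (π : SFun n) → IsDerangement (lookup π) → isDerangement π ≡ true
isDerangement-complete {n} π (injective , no-fixed-point) =
  cong₂ (λ a b → a ∧ not b) (all-tabulate⁺ id _ (λ i → all-tabulate⁺ id _ (λ j → injective-at i j)))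
                            (any-tabulate⁺ id _ not-fixed-at)
  where
  injective-at : ∀ i j → (not ⌊ σ π i Fin.≟ σ π j ⌋ ∨ ⌊ i Fin.≟ j ⌋) ≡ true
  injective-at i j with σ π i Fin.≟ σ π j
  ... | no _ = refl
  ... | yes σi≡σj rewrite ⌊⌋-true (i Fin.≟ j) (injective i j σi≡σj) = refl
  not-fixed-at : ∀ i → (not (neg π i) ∧ ⌊ σ π i Fin.≟ i ⌋) ≡ false
  not-fixed-at i with neg π i in sign
  ... | true = refl
  ... | false = ⌊⌋-false (σ π i Fin.≟ i) (no-fixed-point i sign)

module _ {n} {φ ψ : SignedFun n} (φ≗ψ : ∀ i → φ i ≡ ψ i) where

  private
    perm≗ : ∀ i → perm φ i ≡ perm ψ i
    perm≗ i = cong proj₂ (φ≗ψ i)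

    image≗ : ∀ i → φ (perm φ i) ≡ ψ (perm ψ i)
    image≗ i = trans (φ≗ψ (perm φ i)) (cong ψ (perm≗ i))

    iterate≗ : ∀ k i → iterate (perm φ) k i ≡ iterate (perm ψ) k i
    iterate≗ zero i = refl
    iterate≗ (suc k) i = trans (perm≗ _) (cong (perm ψ) (iterate≗ k i))

    card≗ : ∀ {P Q : Fin n → Bool} → (∀ i → P i ≡ Q i) → card n P ≡ card n Q
    card≗ P≗Q = ∑-cong (allFin n) (cong 𝟙 ∘ P≗Q)

  statsF-cong : statsF φ ≡ statsF ψ
  statsF-cong =
    cong₂ _,_ (card≗ (λ i → cong₂ _≺_ (φ≗ψ i) (image≗ i)))
    (cong₂ _,_ (card≗ (λ i → cong₂ _≺_ (image≗ i) (φ≗ψ i)))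
    (cong₂ _,_ (card≗ (λ i → cong₂ (λ b k → b ∧ ⌊ k Fin.≟ i ⌋) (cong proj₁ (φ≗ψ i)) (perm≗ i)))
               (card≗ (λ i → all-cong (allFin n) (λ k → cong (λ t → ⌊ toℕ i ℕ.≤? toℕ t ⌋) (iterate≗ (toℕ k) i))))))

  IsDerangement-cong : IsDerangement φ → IsDerangement ψ
  IsDerangement-cong (injective , no-fixed-point) =
    (λ i j e → injective i j (trans (perm≗ i) (trans e (sym (perm≗ j))))) ,
    (λ i positive fixed → no-fixed-point i (trans (cong proj₁ (φ≗ψ i)) positive) (trans (perm≗ i) fixed))

OrbitMin : ∀ {n} → (Fin n → Fin n) → Fin n → Set
OrbitMin f i = ∀ k → toℕ i ≤ toℕ (iterate f k i)

iterate-+ : ∀ {n} (f : Fin n → Fin n) a b i → iterate f (a + b) i ≡ iterate f a (iterate f b i)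
iterate-+ f zero b i = refl
iterate-+ f (suc a) b i = cong f (iterate-+ f a b i)

iterate-injective : ∀ {n} (f : Fin n → Fin n) → Injective f → ∀ a x y → iterate f a x ≡ iterate f a y → x ≡ y
iterate-injective f inj zero x y e = e
iterate-injective f inj (suc a) x y e = iterate-injective f inj a x y (inj _ _ e)

-- An injection of Fin n returns every point after some period 0 < p ≤ n (pigeonhole).
period : ∀ {n} (f : Fin n → Fin n) → Injective f → ∀ i → Σ ℕ λ p → 0 < p × p ≤ n × iterate f p i ≡ i
period {n} f inj i with FinP.pigeonhole (ℕP.n<1+n n) (λ (k : Fin (suc n)) → iterate f (toℕ k) i)
... | a , b , a<b , e =
  toℕ b ∸ toℕ a , ℕP.m<n⇒0<n∸m a<b , ℕP.≤-trans (ℕP.m∸n≤m (toℕ b) (toℕ a)) (ℕP.≤-pred (FinP.toℕ<n b)) ,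
  iterate-injective f inj (toℕ a) _ _
    (trans (sym (iterate-+ f (toℕ a) (toℕ b ∸ toℕ a) i))
           (trans (cong (λ t → iterate f t i) (ℕP.m+[n∸m]≡n (ℕP.<⇒≤ a<b))) (sym e)))

reduce : ∀ {n} (f : Fin n → Fin n) i p → 0 < p → iterate f p i ≡ i →
  ∀ k → Σ ℕ λ r → r < p × iterate f k i ≡ iterate f r i
reduce f i p 0<p e zero = 0 , 0<p , refl
reduce f i p 0<p e (suc k) with reduce f i p 0<p e k
... | r , r<p , e' with ℕP.m≤n⇒m<n∨m≡n r<p
... | inj₁ 1+r<p = suc r , 1+r<p , cong f e'
... | inj₂ 1+r≡p = 0 , 0<p , trans (cong f e') (trans (cong (λ t → iterate f t i) 1+r≡p) e)

isOrbitMin-sound : ∀ {n} (f : Fin n → Fin n) → Injective f → ∀ i → isOrbitMin f i ≡ true → OrbitMin f i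
isOrbitMin-sound {n} f inj i min k with period f inj i
... | p , 0<p , p≤n , e with reduce f i p 0<p e k
... | r , r<p , e' =
  subst (λ t → toℕ i ≤ toℕ t) (sym e')
        (subst (λ t → toℕ i ≤ toℕ (iterate f t i)) (FinP.toℕ-fromℕ< r<n)
               (⌊⌋-sound (_ ℕ.≤? _) (all-tabulate⁻ id _ min (fromℕ< r<n))))
  where r<n = ℕP.<-≤-trans r<p p≤n

isOrbitMin-complete : ∀ {n} (f : Fin n → Fin n) i → OrbitMin f i → isOrbitMin f i ≡ true
isOrbitMin-complete {n} f i min = all-tabulate⁺ {n = n} id _ (λ k → ⌊⌋-true (_ ℕ.≤? _) (min (toℕ k)))

bool-ext : ∀ {a b : Bool} → (a ≡ true → b ≡ true) → (b ≡ true → a ≡ true) → a ≡ b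
bool-ext {true} {true} _ _ = refl
bool-ext {true} {false} a⇒b _ = sym (a⇒b refl)
bool-ext {false} {true} _ b⇒a = b⇒a refl
bool-ext {false} {false} _ _ = refl

-- Orbit minima are preserved by an extension g of f to Fin (suc n) in which
-- every orbit of f is traced by g in the same order (orbits of old points may
-- only pick up the new top point).
module _ {n} (f : Fin n → Fin n) (g : Fin (suc n) → Fin (suc n)) (f-inj : Injective f) (g-inj : Injective g) where

  isOrbitMin-lift : ∀ i →
    (∀ l → Σ ℕ λ k → iterate g k (inject₁ i) ≡ inject₁ (iterate f l i)) →
    (∀ k → (Σ ℕ λ l → iterate g k (inject₁ i) ≡ inject₁ (iterate f l i)) ⊎ iterate g k (inject₁ i) ≡ fromℕ n) →
    isOrbitMin g (inject₁ i) ≡ isOrbitMin f i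
  isOrbitMin-lift i g-visits-f g-stays = bool-ext
    (λ e → isOrbitMin-complete f i (λ l → lower-bound l (isOrbitMin-sound g g-inj _ e)))
    (λ e → isOrbitMin-complete g _ (λ k → upper-bound k (isOrbitMin-sound f f-inj i e)))
    where
    lower-bound : ∀ l → OrbitMin g (inject₁ i) → toℕ i ≤ toℕ (iterate f l i)
    lower-bound l min with g-visits-f l
    ... | k , e = subst₂ _≤_ (FinP.toℕ-inject₁ i) (trans (cong toℕ e) (FinP.toℕ-inject₁ _)) (min k)
    upper-bound : ∀ k → OrbitMin f i → toℕ (inject₁ i) ≤ toℕ (iterate g k (inject₁ i))
    upper-bound k min with g-stays k
    ... | inj₁ (l , e) = subst₂ _≤_ (sym (FinP.toℕ-inject₁ i)) (sym (trans (cong toℕ e) (FinP.toℕ-inject₁ _))) (min l)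
    ... | inj₂ e = subst₂ _≤_ (sym (FinP.toℕ-inject₁ i)) (sym (trans (cong toℕ e) (FinP.toℕ-fromℕ n)))
                          (ℕP.<⇒≤ (FinP.toℕ<n i))

module FixedPointOrbits {n} (f : Fin n → Fin n) (g : Fin (suc n) → Fin (suc n)) (f-inj : Injective f) (g-inj : Injective g)
    (g-old : ∀ x → g (inject₁ x) ≡ inject₁ (f x)) (g-new : g (fromℕ n) ≡ fromℕ n) where

  private
    trace : ∀ i k → iterate g k (inject₁ i) ≡ inject₁ (iterate f k i)
    trace i zero = refl
    trace i (suc k) = trans (cong g (trace i k)) (g-old _)

    fixed : ∀ k → iterate g k (fromℕ n) ≡ fromℕ n
    fixed zero = refl
    fixed (suc k) = trans (cong g (fixed k)) g-new

  isOrbitMin-old : ∀ i → isOrbitMin g (inject₁ i) ≡ isOrbitMin f i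
  isOrbitMin-old i = isOrbitMin-lift f g f-inj g-inj i (λ l → l , trace i l) (λ k → inj₁ (k , trace i k))

  isOrbitMin-new : isOrbitMin g (fromℕ n) ≡ true
  isOrbitMin-new = isOrbitMin-complete g _ (λ k → ℕP.≤-reflexive (cong toℕ (sym (fixed k))))

module InsertedOrbits {n} (f : Fin n → Fin n) (g : Fin (suc n) → Fin (suc n)) (j : Fin n)
    (f-inj : Injective f) (g-inj : Injective g)
    (g-old : ∀ x → x ≢ j → g (inject₁ x) ≡ inject₁ (f x))
    (g-j : g (inject₁ j) ≡ fromℕ n) (g-new : g (fromℕ n) ≡ inject₁ (f j)) where

  private
    forward : ∀ i k → (Σ ℕ λ l → iterate g k (inject₁ i) ≡ inject₁ (iterate f l i))
                      ⊎ (iterate g k (inject₁ i) ≡ fromℕ n × Σ ℕ λ l → j ≡ iterate f l i)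
    forward i zero = inj₁ (0 , refl)
    forward i (suc k) with forward i k
    ... | inj₂ (e , l , j-on-orbit) = inj₁ (suc l , trans (cong g e) (trans g-new (cong (inject₁ ∘ f) j-on-orbit)))
    ... | inj₁ (l , e) with iterate f l i Fin.≟ j
    ... | yes at-j = inj₂ (trans (cong g e) (trans (cong (g ∘ inject₁) at-j) g-j) , l , sym at-j)
    ... | no not-at-j = inj₁ (suc l , trans (cong g e) (g-old _ not-at-j))

    -- every f-iterate is reached by g (one extra step when passing j)
    backward : ∀ i l → Σ ℕ λ k → iterate g k (inject₁ i) ≡ inject₁ (iterate f l i)
    backward i zero = 0 , refl
    backward i (suc l) with backward i l
    ... | k , e with iterate f l i Fin.≟ j
    ... | yes at-j = suc (suc k) , trans (cong g (trans (cong g e) (trans (cong (g ∘ inject₁) at-j) g-j)))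
                                       (trans g-new (cong (inject₁ ∘ f) (sym at-j)))
    ... | no not-at-j = suc k , trans (cong g e) (g-old _ not-at-j)

    forget : ∀ i k → (Σ ℕ λ l → iterate g k (inject₁ i) ≡ inject₁ (iterate f l i)) ⊎ iterate g k (inject₁ i) ≡ fromℕ n
    forget i k with forward i k
    ... | inj₁ r = inj₁ r
    ... | inj₂ (e , _) = inj₂ e

  isOrbitMin-old : ∀ i → isOrbitMin g (inject₁ i) ≡ isOrbitMin f i
  isOrbitMin-old i = isOrbitMin-lift f g f-inj g-inj i (backward i) (forget i)

  -- the new top point is not a minimum: its successor is smaller
  isOrbitMin-new : isOrbitMin g (fromℕ n) ≡ false
  isOrbitMin-new with isOrbitMin g (fromℕ n) in e
  ... | false = refl
  ... | true = ⊥-elim (ℕP.<-irrefl refl (ℕP.<-≤-trans (FinP.toℕ<n (f j)) top≤next))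
    where
    top≤next : n ≤ toℕ (f j)
    top≤next = subst₂ _≤_ (FinP.toℕ-fromℕ n) (trans (cong toℕ g-new) (FinP.toℕ-inject₁ (f j)))
                      (isOrbitMin-sound g g-inj (fromℕ n) e 1)

unlast : ∀ {n} → Fin (suc n) → Maybe (Fin n)
unlast {zero} Fin.zero = nothing
unlast {suc n} Fin.zero = just Fin.zero
unlast {suc n} (Fin.suc x) = Maybe.map Fin.suc (unlast x)

unlast-inject₁ : ∀ {n} (i : Fin n) → unlast (inject₁ i) ≡ just i
unlast-inject₁ {suc n} Fin.zero = refl
unlast-inject₁ {suc n} (Fin.suc i) rewrite unlast-inject₁ i = refl

unlast-fromℕ : ∀ n → unlast (fromℕ n) ≡ nothing
unlast-fromℕ zero = refl
unlast-fromℕ (suc n) rewrite unlast-fromℕ n = refl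

last-view : ∀ {n} (x : Fin (suc n)) → (Σ (Fin n) λ i → x ≡ inject₁ i) ⊎ x ≡ fromℕ n
last-view {zero} Fin.zero = inj₂ refl
last-view {suc n} Fin.zero = inj₁ (Fin.zero , refl)
last-view {suc n} (Fin.suc x) with last-view x
... | inj₁ (i , refl) = inj₁ (Fin.suc i , refl)
... | inj₂ refl = inj₂ refl

new≢old : ∀ {n} {i : Fin n} → fromℕ n ≢ inject₁ i
new≢old = FinP.fromℕ≢inject₁

old≢new : ∀ {n} {i : Fin n} → inject₁ i ≢ fromℕ n
old≢new e = new≢old (sym e)

liftS : ∀ {n} → Signed n → Signed (suc n)
liftS u = proj₁ u , inject₁ (proj₂ u)

value-lift : ∀ {n} (u : Signed n) → value (liftS u) ≡ value u
value-lift (b , i) = cong (λ t → if b then - (+ suc t) else + suc t) (FinP.toℕ-inject₁ i)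

value-injective : ∀ {n} (u v : Signed n) → proj₂ u ≢ proj₂ v → value u ≢ value v
value-injective (true , i) (true , j) i≢j e = i≢j (FinP.toℕ-injective (ℕP.suc-injective (ℤP.+-injective (ℤP.neg-injective e))))
value-injective (true , i) (false , j) i≢j ()
value-injective (false , i) (true , j) i≢j ()
value-injective (false , i) (false , j) i≢j e = i≢j (FinP.toℕ-injective (ℕP.suc-injective (ℤP.+-injective e)))

value-below-new : ∀ {n} (u : Signed n) → value u ℤ.< value {suc n} (false , fromℕ n)
value-below-new {n} (true , i) = subst (λ t → value (true , i) ℤ.< + suc t) (sym (FinP.toℕ-fromℕ n)) ℤ.-<+
value-below-new {n} (false , i) = subst (λ t → value (false , i) ℤ.< + suc t) (sym (FinP.toℕ-fromℕ n)) (ℤ.+<+ (ℕ.s≤s (FinP.toℕ<n i)))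

value-above-new : ∀ {n} (u : Signed n) → value {suc n} (true , fromℕ n) ℤ.< value u
value-above-new {n} (true , i) = subst (λ t → - (+ suc t) ℤ.< value (true , i)) (sym (FinP.toℕ-fromℕ n)) (ℤ.-<- (FinP.toℕ<n i))
value-above-new {n} (false , i) = subst (λ t → - (+ suc t) ℤ.< value (false , i)) (sym (FinP.toℕ-fromℕ n)) ℤ.-<+

-- Insertion of the point n+1 into a signed permutation of [n].
--   nothing            : n+1 forms the new singleton cycle (−(n+1));
--   just (p , s₁ , s₂) : with j = |π(p)|, put π'(j) = ±(n+1) (sign s₁) and
--                        π'(n+1) = ±|π(j)| (sign s₂), i.e. insert ±(n+1) right
--                        after the entry π(p) in the cycle notation of π.
Tag : ℕ → Set
Tag n = Maybe (Fin n × Bool × Bool)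

insertAt : ∀ {n} → SignedFun n → Tag n → Maybe (Fin n) → Signed (suc n)
insertAt φ nothing (just i) = liftS (φ i)
insertAt {n} φ nothing nothing = true , fromℕ n
insertAt {n} φ (just (p , s₁ , s₂)) (just i) = if ⌊ i Fin.≟ perm φ p ⌋ then (s₁ , fromℕ n) else liftS (φ i)
insertAt φ (just (p , s₁ , s₂)) nothing = s₂ , inject₁ (perm φ (perm φ p))

insert : ∀ {n} → SignedFun n → Tag n → SignedFun (suc n)
insert φ t x = insertAt φ t (unlast x)

-- s₂ must be the sign of π(j), unless j is a singleton cycle (then both signs occur).
validTag : ∀ {n} → SignedFun n → Tag n → Bool
validTag φ nothing = true
validTag φ (just (p , s₁ , s₂)) = ⌊ s₂ Bool.≟ negative φ (perm φ p) ⌋ ∨ ⌊ perm φ (perm φ p) Fin.≟ perm φ p ⌋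

module InsertNew {n} (φ : SignedFun n) where

  φ' : SignedFun (suc n)
  φ' = insert φ nothing

  at-old : ∀ i → φ' (inject₁ i) ≡ liftS (φ i)
  at-old i = cong (insertAt φ nothing) (unlast-inject₁ i)

  at-new : φ' (fromℕ n) ≡ (true , fromℕ n)
  at-new = cong (insertAt φ nothing) (unlast-fromℕ n)

  perm-old : ∀ i → perm φ' (inject₁ i) ≡ inject₁ (perm φ i)
  perm-old i = cong proj₂ (at-old i)

  perm-new : perm φ' (fromℕ n) ≡ fromℕ n
  perm-new = cong proj₂ at-new

  isDerangement-new : IsDerangement φ → IsDerangement φ'
  isDerangement-new (injective , no-fixed-point) = injective' , no-fixed-point'
    where
    injective' : Injective (perm φ')
    injective' x y e with last-view x | last-view y
    ... | inj₁ (a , refl) | inj₁ (b , refl) =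
          cong inject₁ (injective a b (FinP.inject₁-injective (trans (sym (perm-old a)) (trans e (perm-old b)))))
    ... | inj₁ (a , refl) | inj₂ refl = ⊥-elim (old≢new (trans (sym (perm-old a)) (trans e perm-new)))
    ... | inj₂ refl | inj₁ (b , refl) = ⊥-elim (new≢old (trans (sym perm-new) (trans e (perm-old b))))
    ... | inj₂ refl | inj₂ refl = refl
    no-fixed-point' : NoFixedPoint φ'
    no-fixed-point' x positive fixed with last-view x
    ... | inj₁ (a , refl) = no-fixed-point a (trans (sym (cong proj₁ (at-old a))) positive)
                                             (FinP.inject₁-injective (trans (sym (perm-old a)) fixed))
    ... | inj₂ refl with () ← trans (sym (cong proj₁ at-new)) positive

module InsertAfter {n} (φ : SignedFun n) (p : Fin n) (s₁ s₂ : Bool) where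

  j : Fin n
  j = perm φ p

  φ' : SignedFun (suc n)
  φ' = insert φ (just (p , s₁ , s₂))

  at-old : ∀ i → i ≢ j → φ' (inject₁ i) ≡ liftS (φ i)
  at-old i i≢j = trans (cong (insertAt φ (just (p , s₁ , s₂))) (unlast-inject₁ i))
                       (cong (λ b → if b then (s₁ , fromℕ n) else liftS (φ i)) (⌊⌋-false (i Fin.≟ j) i≢j))

  at-j : φ' (inject₁ j) ≡ (s₁ , fromℕ n)
  at-j = trans (cong (insertAt φ (just (p , s₁ , s₂))) (unlast-inject₁ j))
               (cong (λ b → if b then (s₁ , fromℕ n) else liftS (φ j)) (⌊⌋-true (j Fin.≟ j) refl))

  at-new : φ' (fromℕ n) ≡ (s₂ , inject₁ (perm φ j))
  at-new = cong (insertAt φ (just (p , s₁ , s₂))) (unlast-fromℕ n)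

  perm-old : ∀ i → i ≢ j → perm φ' (inject₁ i) ≡ inject₁ (perm φ i)
  perm-old i i≢j = cong proj₂ (at-old i i≢j)

  perm-j : perm φ' (inject₁ j) ≡ fromℕ n
  perm-j = cong proj₂ at-j

  perm-new : perm φ' (fromℕ n) ≡ inject₁ (perm φ j)
  perm-new = cong proj₂ at-new

  data PointView : Fin (suc n) → Set where
    old : ∀ a → a ≢ j → perm φ' (inject₁ a) ≡ inject₁ (perm φ a) → PointView (inject₁ a)
    at-j-point : PointView (inject₁ j)
    new-point : PointView (fromℕ n)

  point-view : ∀ x → PointView x
  point-view x with last-view x
  ... | inj₂ refl = new-point
  ... | inj₁ (a , refl) with a Fin.≟ j
  ... | yes refl = at-j-point
  ... | no a≢j = old a a≢j (perm-old a a≢j)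

  isDerangement-after : IsDerangement φ → IsDerangement φ'
  isDerangement-after (injective , no-fixed-point) = injective' , no-fixed-point'
    where
    lower : ∀ {a b} → inject₁ (perm φ a) ≡ inject₁ (perm φ b) → a ≡ b
    lower e = injective _ _ (FinP.inject₁-injective e)
    injective' : Injective (perm φ')
    injective' x y e with point-view x | point-view y
    ... | old a _ ea | old b _ eb = cong inject₁ (lower (trans (sym ea) (trans e eb)))
    ... | old a _ ea | at-j-point = ⊥-elim (old≢new (trans (sym ea) (trans e perm-j)))
    ... | old a a≢j ea | new-point = ⊥-elim (a≢j (lower (trans (sym ea) (trans e perm-new))))
    ... | at-j-point | old b _ eb = ⊥-elim (new≢old (trans (sym perm-j) (trans e eb)))
    ... | at-j-point | at-j-point = refl
    ... | at-j-point | new-point = ⊥-elim (new≢old (trans (sym perm-j) (trans e perm-new)))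
    ... | new-point | old b b≢j eb = ⊥-elim (b≢j (lower (sym (trans (sym perm-new) (trans e eb)))))
    ... | new-point | at-j-point = ⊥-elim (old≢new (trans (sym perm-new) (trans e perm-j)))
    ... | new-point | new-point = refl
    no-fixed-point' : NoFixedPoint φ'
    no-fixed-point' x positive fixed with point-view x
    ... | old a a≢j ea = no-fixed-point a (trans (sym (cong proj₁ (at-old a a≢j))) positive)
                                          (FinP.inject₁-injective (trans (sym ea) fixed))
    ... | at-j-point = new≢old (trans (sym perm-j) fixed)
    ... | new-point = old≢new (trans (sym perm-new) fixed)

valid-sign : ∀ {n} (φ : SignedFun n) p s₁ s₂ → validTag φ (just (p , s₁ , s₂)) ≡ true →
  perm φ (perm φ p) ≢ perm φ p → s₂ ≡ negative φ (perm φ p)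
valid-sign φ p s₁ s₂ valid moves =
  ⌊⌋-sound (s₂ Bool.≟ negative φ (perm φ p)) (∨-left valid (⌊⌋-false (perm φ (perm φ p) Fin.≟ perm φ p) moves))
  where
  ∨-left : ∀ {a b} → a ∨ b ≡ true → b ≡ false → a ≡ true
  ∨-left {true} _ _ = refl
  ∨-left {false} a∨b b≡false = trans (sym b≡false) a∨b

insert-derangement : ∀ {n} (φ : SignedFun n) → IsDerangement φ → ∀ t → IsDerangement (insert φ t)
insert-derangement φ d nothing = InsertNew.isDerangement-new φ d
insert-derangement φ d (just (p , s₁ , s₂)) = InsertAfter.isDerangement-after φ p s₁ s₂ d

module _ {n} {φ ψ : SignedFun n} (φ≗ψ : ∀ i → φ i ≡ ψ i) where

  private
    perm≗ : ∀ i → perm φ i ≡ perm ψ i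
    perm≗ i = cong proj₂ (φ≗ψ i)

    perm²≗ : ∀ i → perm φ (perm φ i) ≡ perm ψ (perm ψ i)
    perm²≗ i = trans (perm≗ _) (cong (perm ψ) (perm≗ i))

  insert-cong : ∀ t x → insert φ t x ≡ insert ψ t x
  insert-cong t x with unlast x
  insert-cong nothing x | just i = cong liftS (φ≗ψ i)
  insert-cong nothing x | nothing = refl
  insert-cong (just (p , s₁ , s₂)) x | just i =
    cong₂ (λ k u → if ⌊ i Fin.≟ k ⌋ then (s₁ , fromℕ n) else liftS u) (perm≗ p) (φ≗ψ i)
  insert-cong (just (p , s₁ , s₂)) x | nothing = cong (λ k → s₂ , inject₁ k) (perm²≗ p)

  validTag-cong : ∀ t → validTag φ t ≡ validTag ψ t
  validTag-cong nothing = refl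
  validTag-cong (just (p , s₁ , s₂)) =
    cong₂ _∨_ (cong (λ b → ⌊ s₂ Bool.≟ b ⌋) (trans (cong proj₁ (φ≗ψ _)) (cong (negative ψ) (perm≗ p))))
              (cong₂ (λ k l → ⌊ k Fin.≟ l ⌋) (perm²≗ p) (perm≗ p))

card-last : ∀ n (P : Fin (suc n) → Bool) → card (suc n) P ≡ card n (P ∘ inject₁) + 𝟙 (P (fromℕ n))
card-last n P = ∑-allFin-last n (𝟙 ∘ P)

≺-lift : ∀ {n} (u v : Signed n) → liftS u ≺ liftS v ≡ u ≺ v
≺-lift u v = cong₂ (λ x y → ⌊ x ℤ.<? y ⌋) (value-lift u) (value-lift v)

≺-irrefl : ∀ {n} (u : Signed n) → u ≺ u ≡ false
≺-irrefl u = ⌊⌋-false (value u ℤ.<? value u) (ℤP.<-irrefl refl)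

≺-exactly-one : ∀ {n} (u v : Signed n) → proj₂ u ≢ proj₂ v → 𝟙 (u ≺ v) + 𝟙 (v ≺ u) ≡ 1
≺-exactly-one u v u≢v with value u ℤ.<? value v | value v ℤ.<? value u
... | yes u<v | yes v<u = ⊥-elim (ℤP.<-asym u<v v<u)
... | yes _ | no _ = refl
... | no _ | yes _ = refl
... | no u≮v | no v≮u = ⊥-elim (v≮u (ℤP.≤∧≢⇒< (ℤP.≮⇒≥ u≮v) (value-injective v u (u≢v ∘ sym))))

-- a new extreme value ±(n+1) between two old ones makes exactly one ascent
≺-around-new : ∀ {n} (s : Bool) (u v : Signed n) → 𝟙 (liftS u ≺ (s , fromℕ n)) + 𝟙 ((s , fromℕ n) ≺ liftS v) ≡ 1
≺-around-new {n} false u v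
  rewrite ⌊⌋-true (value (liftS u) ℤ.<? value {suc n} (false , fromℕ n)) (subst (ℤ._< _) (sym (value-lift u)) (value-below-new u))
        | ⌊⌋-false (value {suc n} (false , fromℕ n) ℤ.<? value (liftS v))
                   (ℤP.<-asym (subst (ℤ._< _) (sym (value-lift v)) (value-below-new v))) = refl
≺-around-new {n} true u v
  rewrite ⌊⌋-false (value (liftS u) ℤ.<? value {suc n} (true , fromℕ n))
                   (ℤP.<-asym (subst (_ ℤ.<_) (sym (value-lift u)) (value-above-new u)))
        | ⌊⌋-true (value {suc n} (true , fromℕ n) ℤ.<? value (liftS v)) (subst (_ ℤ.<_) (sym (value-lift v)) (value-above-new v)) = refl

module _ {n} (φ' : SignedFun (suc n)) {x} {u v : Signed n} (at-x : φ' x ≡ liftS u) (after-x : φ' (perm φ' x) ≡ liftS v) where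

  ascent-lifted : ascentAt φ' x ≡ u ≺ v
  ascent-lifted = trans (cong₂ _≺_ at-x after-x) (≺-lift u v)

  descent-lifted : descentAt φ' x ≡ v ≺ u
  descent-lifted = trans (cong₂ _≺_ after-x at-x) (≺-lift v u)

singleAt-lifted : ∀ {n} (φ' : SignedFun (suc n)) (φ : SignedFun n) i → φ' (inject₁ i) ≡ liftS (φ i) →
  singleAt φ' (inject₁ i) ≡ singleAt φ i
singleAt-lifted φ' φ i e =
  cong₂ _∧_ (cong proj₁ e) (trans (cong (λ k → ⌊ k Fin.≟ inject₁ i ⌋) (cong proj₂ e))
                                  (⌊⌋-⇔ (mk⇔ FinP.inject₁-injective (cong inject₁)) (inject₁ (perm φ i) Fin.≟ inject₁ i) (perm φ i Fin.≟ i)))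

succ≡ : ∀ x → x + 1 ≡ suc x
succ≡ x = ℕP.+-comm x 1

+0≡+1 : ∀ {x y} → x + 0 ≡ y + 1 → x ≡ suc y
+0≡+1 {x} {y} e = trans (sym (ℕP.+-identityʳ x)) (trans e (succ≡ y))

+1≡+1 : ∀ {x y} → x + 1 ≡ y + 1 → x ≡ y
+1≡+1 {x} {y} = ℕP.+-cancelʳ-≡ 1 x y

+0≡+0 : ∀ {x y} → x + 0 ≡ y + 0 → x ≡ y
+0≡+0 {x} {y} = ℕP.+-cancelʳ-≡ 0 x y

+1≡+0 : ∀ {x y} → x + 1 ≡ y + 0 → x ≡ pred y
+1≡+0 {x} {y} e = cong pred (trans (sym (succ≡ x)) (trans e (ℕP.+-identityʳ y)))

module StatsNew {n} (φ : SignedFun n) (derangement : IsDerangement φ) where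
  open InsertNew φ

  private
    after-old : ∀ i → φ' (perm φ' (inject₁ i)) ≡ liftS (φ (perm φ i))
    after-old i = trans (cong φ' (perm-old i)) (at-old _)

    after-new : φ' (perm φ' (fromℕ n)) ≡ φ' (fromℕ n)
    after-new = cong φ' perm-new

    derangement' = isDerangement-new derangement
    module Cycles = FixedPointOrbits (perm φ) (perm φ') (proj₁ derangement) (proj₁ derangement') perm-old perm-new

    wexc-new : wexcF φ' ≡ wexcF φ
    wexc-new = trans (card-last n (ascentAt φ'))
      (trans (cong₂ _+_ (∑-cong (allFin n) (λ i → cong 𝟙 (ascent-lifted φ' (at-old i) (after-old i))))
                        (cong 𝟙 (trans (cong (φ' (fromℕ n) ≺_) after-new) (≺-irrefl _))))
             (ℕP.+-identityʳ _))

    aexc-new : aexcF φ' ≡ aexcF φ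
    aexc-new = trans (card-last n (descentAt φ'))
      (trans (cong₂ _+_ (∑-cong (allFin n) (λ i → cong 𝟙 (descent-lifted φ' (at-old i) (after-old i))))
                        (cong 𝟙 (trans (cong (_≺ φ' (fromℕ n)) after-new) (≺-irrefl _))))
             (ℕP.+-identityʳ _))

    single-new : singleF φ' ≡ suc (singleF φ)
    single-new = trans (card-last n (singleAt φ'))
      (trans (cong₂ _+_ (∑-cong (allFin n) (λ i → cong 𝟙 (singleAt-lifted φ' φ i (at-old i))))
                        (cong 𝟙 (cong₂ _∧_ (cong proj₁ at-new)
                                           (trans (cong (λ k → ⌊ k Fin.≟ fromℕ n ⌋) perm-new) (⌊⌋-true (fromℕ n Fin.≟ fromℕ n) refl)))))
             (succ≡ _))

    cyc-new : cycF φ' ≡ suc (cycF φ)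
    cyc-new = trans (card-last n (cycleMinAt φ'))
      (trans (cong₂ _+_ (∑-cong (allFin n) (cong 𝟙 ∘ Cycles.isOrbitMin-old)) (cong 𝟙 Cycles.isOrbitMin-new))
             (succ≡ _))

  statsF-new : statsF φ' ≡ (wexcF φ , aexcF φ , suc (singleF φ) , suc (cycF φ))
  statsF-new = cong₂ _,_ wexc-new (cong₂ _,_ aexc-new (cong₂ _,_ single-new cyc-new))

recount-one : ∀ n (P : Fin n → Bool) (P' : Fin (suc n) → Bool) j → (∀ i → i ≢ j → P' (inject₁ i) ≡ P i) →
  card (suc n) P' + 𝟙 (P j) ≡ card n P + (𝟙 (P' (inject₁ j)) + 𝟙 (P' (fromℕ n)))
recount-one n P P' j agree = begin
  card (suc n) P' + h j          ≡⟨ cong (_+ h j) (card-last n P') ⟩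
  ∑ (allFin n) g + new + h j     ≡⟨ exchange (∑ (allFin n) g) new (h j) ⟩
  ∑ (allFin n) g + h j + new     ≡⟨ cong (_+ new) (∑-update₁ n g h j (λ i i≢j → cong 𝟙 (agree i i≢j))) ⟩
  card n P + g j + new           ≡⟨ ℕP.+-assoc (card n P) (g j) new ⟩
  card n P + (g j + new)         ∎
  where
  open ≡-Reasoning
  g = 𝟙 ∘ P' ∘ inject₁
  h = 𝟙 ∘ P
  new = 𝟙 (P' (fromℕ n))
  exchange : ∀ a b c → a + b + c ≡ a + c + b
  exchange = solve-∀

recount-two : ∀ n (P : Fin n → Bool) (P' : Fin (suc n) → Bool) p j → p ≢ j →
  (∀ i → i ≢ p → i ≢ j → P' (inject₁ i) ≡ P i) → P' (fromℕ n) ≡ P j →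
  card (suc n) P' + 𝟙 (P p) ≡ card n P + (𝟙 (P' (inject₁ p)) + 𝟙 (P' (inject₁ j)))
recount-two n P P' p j p≢j agree new≡j = begin
  card (suc n) P' + h p              ≡⟨ cong (_+ h p) (card-last n P') ⟩
  ∑ (allFin n) g + new + h p         ≡⟨ cong (λ t → ∑ (allFin n) g + 𝟙 t + h p) new≡j ⟩
  ∑ (allFin n) g + h j + h p         ≡⟨ exchange (∑ (allFin n) g) (h j) (h p) ⟩
  ∑ (allFin n) g + h p + h j         ≡⟨ ∑-update₂ n g h p j p≢j (λ i i≢p i≢j → cong 𝟙 (agree i i≢p i≢j)) ⟩
  card n P + g p + g j               ≡⟨ ℕP.+-assoc (card n P) (g p) (g j) ⟩
  card n P + (g p + g j)             ∎
  where
  open ≡-Reasoning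
  g = 𝟙 ∘ P' ∘ inject₁
  h = 𝟙 ∘ P
  new = 𝟙 (P' (fromℕ n))
  exchange : ∀ a b c → a + b + c ≡ a + c + b
  exchange = solve-∀

module StatsAfter {n} (φ : SignedFun n) (derangement : IsDerangement φ) (p : Fin n) (s₁ s₂ : Bool) where
  open InsertAfter φ p s₁ s₂

  private
    injective = proj₁ derangement
    derangement' = isDerangement-after derangement
    module Cycles = InsertedOrbits (perm φ) (perm φ') j injective (proj₁ derangement') perm-old perm-j perm-new

    after-old : ∀ i → i ≢ p → i ≢ j → φ' (perm φ' (inject₁ i)) ≡ liftS (φ (perm φ i))
    after-old i i≢p i≢j = trans (cong φ' (perm-old i i≢j)) (at-old _ (λ e → i≢p (injective i p e)))

    ascent-old : ∀ i → i ≢ p → i ≢ j → ascentAt φ' (inject₁ i) ≡ ascentAt φ i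
    ascent-old i i≢p i≢j = ascent-lifted φ' (at-old i i≢j) (after-old i i≢p i≢j)

    descent-old : ∀ i → i ≢ p → i ≢ j → descentAt φ' (inject₁ i) ≡ descentAt φ i
    descent-old i i≢p i≢j = descent-lifted φ' (at-old i i≢j) (after-old i i≢p i≢j)

    single-old : ∀ i → i ≢ j → singleAt φ' (inject₁ i) ≡ singleAt φ i
    single-old i i≢j = singleAt-lifted φ' φ i (at-old i i≢j)

    single-j : singleAt φ' (inject₁ j) ≡ false
    single-j = trans (cong₂ _∧_ refl (trans (cong (λ k → ⌊ k Fin.≟ inject₁ j ⌋) perm-j) (⌊⌋-false (fromℕ n Fin.≟ inject₁ j) new≢old)))
                     (∧-zeroʳ _)

    single-new : singleAt φ' (fromℕ n) ≡ false
    single-new = trans (cong₂ _∧_ refl (trans (cong (λ k → ⌊ k Fin.≟ fromℕ n ⌋) perm-new) (⌊⌋-false (inject₁ (perm φ j) Fin.≟ fromℕ n) old≢new)))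
                       (∧-zeroʳ _)

  -- the cycle structure is unchanged: n+1 joins an existing cycle
  cyc-after : cycF φ' ≡ cycF φ
  cyc-after = trans (card-last n (cycleMinAt φ'))
    (trans (cong₂ _+_ (∑-cong (allFin n) (cong 𝟙 ∘ Cycles.isOrbitMin-old)) (cong 𝟙 Cycles.isOrbitMin-new))
           (ℕP.+-identityʳ _))

  -- j is a singleton cycle (−j); it becomes the 2-cycle (j, n+1).
  module Singleton (p-fixed : perm φ p ≡ p) where

    private
      j-fixed : perm φ j ≡ j
      j-fixed = cong (perm φ) p-fixed

      j-negative : negative φ j ≡ true
      j-negative with negative φ j in sign
      ... | true = refl
      ... | false = ⊥-elim (proj₂ derangement j sign j-fixed)

      at-new' : φ' (fromℕ n) ≡ (s₂ , inject₁ j)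
      at-new' = trans at-new (cong (λ k → s₂ , inject₁ k) j-fixed)

      after-j : φ' (perm φ' (inject₁ j)) ≡ (s₂ , inject₁ j)
      after-j = trans (cong φ' perm-j) at-new'

      after-new : φ' (perm φ' (fromℕ n)) ≡ (s₁ , fromℕ n)
      after-new = trans (cong φ' (trans perm-new (cong inject₁ j-fixed))) at-j

      others : ∀ i → i ≢ j → i ≢ p
      others i i≢j i≡p = i≢j (trans i≡p (sym p-fixed))

      -- the new 2-cycle (j, n+1) has one ascent and one descent, j had neither
      ascents-j : 𝟙 (ascentAt φ' (inject₁ j)) + 𝟙 (ascentAt φ' (fromℕ n)) ≡ 1
      ascents-j = trans (cong₂ (λ x y → 𝟙 x + 𝟙 y) (cong₂ _≺_ at-j after-j) (cong₂ _≺_ at-new' after-new))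
                        (≺-exactly-one (s₁ , fromℕ n) (s₂ , inject₁ j) new≢old)

      descents-j : 𝟙 (descentAt φ' (inject₁ j)) + 𝟙 (descentAt φ' (fromℕ n)) ≡ 1
      descents-j = trans (cong₂ (λ x y → 𝟙 x + 𝟙 y) (cong₂ _≺_ after-j at-j) (cong₂ _≺_ after-new at-new'))
                         (≺-exactly-one (s₂ , inject₁ j) (s₁ , fromℕ n) old≢new)

      no-ascent-j : ascentAt φ j ≡ false
      no-ascent-j = trans (cong (φ j ≺_) (cong φ j-fixed)) (≺-irrefl (φ j))

      no-descent-j : descentAt φ j ≡ false
      no-descent-j = trans (cong (_≺ φ j) (cong φ j-fixed)) (≺-irrefl (φ j))

      single-at-j : singleAt φ j ≡ true
      single-at-j = cong₂ _∧_ j-negative (trans (cong (λ k → ⌊ k Fin.≟ j ⌋) j-fixed) (⌊⌋-true (j Fin.≟ j) refl))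

      wexc-singleton : wexcF φ' + 0 ≡ wexcF φ + 1
      wexc-singleton =
        trans (cong (λ b → wexcF φ' + 𝟙 b) (sym no-ascent-j))
              (trans (recount-one n (ascentAt φ) (ascentAt φ') j (λ i i≢j → ascent-old i (others i i≢j) i≢j))
                     (cong (_+_ (wexcF φ)) ascents-j))

      aexc-singleton : aexcF φ' + 0 ≡ aexcF φ + 1
      aexc-singleton =
        trans (cong (λ b → aexcF φ' + 𝟙 b) (sym no-descent-j))
              (trans (recount-one n (descentAt φ) (descentAt φ') j (λ i i≢j → descent-old i (others i i≢j) i≢j))
                     (cong (_+_ (aexcF φ)) descents-j))

      single-singleton : singleF φ' + 1 ≡ singleF φ + 0
      single-singleton =
        trans (cong (λ b → singleF φ' + 𝟙 b) (sym single-at-j))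
              (trans (recount-one n (singleAt φ) (singleAt φ') j single-old)
                     (cong (λ x → singleF φ + x) (cong₂ (λ x y → 𝟙 x + 𝟙 y) single-j single-new)))

    statsF-singleton : statsF φ' ≡ (suc (wexcF φ) , suc (aexcF φ) , pred (singleF φ) , cycF φ)
    statsF-singleton =
      cong₂ _,_ (+0≡+1 wexc-singleton) (cong₂ _,_ (+0≡+1 aexc-singleton) (cong₂ _,_ (+1≡+0 single-singleton) cyc-after))

  -- j lies on a longer cycle; the tag is valid, so π'(n+1) = π(j).
  module NonSingleton (valid : validTag φ (just (p , s₁ , s₂)) ≡ true) (p≢j : p ≢ j) where

    private
      j-moves : perm φ j ≢ j
      j-moves e = p≢j (sym (injective j p e))

      sign-kept : s₂ ≡ negative φ j
      sign-kept = valid-sign φ p s₁ s₂ valid j-moves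

      at-new' : φ' (fromℕ n) ≡ liftS (φ j)
      at-new' = trans at-new (cong (λ b → b , inject₁ (perm φ j)) sign-kept)

      after-p : φ' (perm φ' (inject₁ p)) ≡ (s₁ , fromℕ n)
      after-p = trans (cong φ' (perm-old p p≢j)) at-j

      after-j : φ' (perm φ' (inject₁ j)) ≡ liftS (φ j)
      after-j = trans (cong φ' perm-j) at-new'

      after-new : φ' (perm φ' (fromℕ n)) ≡ liftS (φ (perm φ j))
      after-new = trans (cong φ' perm-new) (at-old _ j-moves)

      -- π(p), ±(n+1), π(j) replaces π(p), π(j): exactly one of the two new pairs ascends
      ascents-pj : 𝟙 (ascentAt φ' (inject₁ p)) + 𝟙 (ascentAt φ' (inject₁ j)) ≡ 1
      ascents-pj = trans (cong₂ (λ x y → 𝟙 x + 𝟙 y) (cong₂ _≺_ (at-old p p≢j) after-p) (cong₂ _≺_ at-j after-j))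
                         (≺-around-new s₁ (φ p) (φ j))

      descents-pj : 𝟙 (descentAt φ' (inject₁ p)) + 𝟙 (descentAt φ' (inject₁ j)) ≡ 1
      descents-pj = trans (ℕP.+-comm (𝟙 (descentAt φ' (inject₁ p))) _)
                    (trans (cong₂ (λ x y → 𝟙 x + 𝟙 y) (cong₂ _≺_ after-j at-j) (cong₂ _≺_ after-p (at-old p p≢j)))
                           (≺-around-new s₁ (φ j) (φ p)))

      -- and the pair π(j), π(π(j)) moves from j to n+1
      wexc-after : wexcF φ' + 𝟙 (ascentAt φ p) ≡ wexcF φ + 1
      wexc-after = trans (recount-two n (ascentAt φ) (ascentAt φ') p j p≢j ascent-old (ascent-lifted φ' at-new' after-new))
                         (cong (_+_ (wexcF φ)) ascents-pj)

      aexc-after : aexcF φ' + 𝟙 (descentAt φ p) ≡ aexcF φ + 1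
      aexc-after = trans (recount-two n (descentAt φ) (descentAt φ') p j p≢j descent-old (descent-lifted φ' at-new' after-new))
                         (cong (_+_ (aexcF φ)) descents-pj)

      single-after : singleF φ' + 0 ≡ singleF φ + 0
      single-after =
        trans (cong (λ b → singleF φ' + 𝟙 b) (sym (trans (cong₂ _∧_ refl (⌊⌋-false (perm φ j Fin.≟ j) j-moves)) (∧-zeroʳ _))))
              (trans (recount-one n (singleAt φ) (singleAt φ') j single-old)
                     (cong (λ x → singleF φ + x) (cong₂ (λ x y → 𝟙 x + 𝟙 y) single-j single-new)))

      ascent-or-descent : 𝟙 (ascentAt φ p) + 𝟙 (descentAt φ p) ≡ 1
      ascent-or-descent = ≺-exactly-one (φ p) (φ j) (λ e → j-moves (sym e))

    statsF-ascent : ascentAt φ p ≡ true → statsF φ' ≡ (wexcF φ , suc (aexcF φ) , singleF φ , cycF φ)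
    statsF-ascent ascent =
      cong₂ _,_ (+1≡+1 (subst (λ b → wexcF φ' + 𝟙 b ≡ wexcF φ + 1) ascent wexc-after))
      (cong₂ _,_ (+0≡+1 (subst (λ b → aexcF φ' + 𝟙 b ≡ aexcF φ + 1) no-descent aexc-after))
      (cong₂ _,_ (+0≡+0 single-after) cyc-after))
      where
      no-descent : descentAt φ p ≡ false
      no-descent with descentAt φ p | ascent-or-descent
      ... | false | _ = refl
      ... | true | e rewrite ascent with () ← e

    statsF-descent : ascentAt φ p ≡ false → statsF φ' ≡ (suc (wexcF φ) , aexcF φ , singleF φ , cycF φ)
    statsF-descent no-ascent =
      cong₂ _,_ (+0≡+1 (subst (λ b → wexcF φ' + 𝟙 b ≡ wexcF φ + 1) no-ascent wexc-after))
      (cong₂ _,_ (+1≡+1 (subst (λ b → aexcF φ' + 𝟙 b ≡ aexcF φ + 1) descent aexc-after))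
      (cong₂ _,_ (+0≡+0 single-after) cyc-after))
      where
      descent : descentAt φ p ≡ true
      descent with descentAt φ p | ascent-or-descent
      ... | true | _ = refl
      ... | false | e rewrite no-ascent with () ← e

liftS-injective : ∀ {n} {u v : Signed n} → liftS u ≡ liftS v → u ≡ v
liftS-injective e = cong₂ _,_ (cong proj₁ e) (FinP.inject₁-injective (cong proj₂ e))

fixed⇒negative : ∀ {n} (φ : SignedFun n) → NoFixedPoint φ → ∀ i → perm φ i ≡ i → negative φ i ≡ true
fixed⇒negative φ no-fixed-point i fixed with negative φ i in sign
... | true = refl
... | false = ⊥-elim (no-fixed-point i sign fixed)

insert-injective : ∀ {n} (φ ψ : SignedFun n) (t u : Tag n) → IsDerangement φ → IsDerangement ψ →
  validTag φ t ≡ true → validTag ψ u ≡ true → (∀ x → insert φ t x ≡ insert ψ u x) → (∀ i → φ i ≡ ψ i) × t ≡ u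
insert-injective {n} φ ψ nothing nothing _ _ _ _ same =
  (λ i → liftS-injective (trans (sym (InsertNew.at-old φ i)) (trans (same (inject₁ i)) (InsertNew.at-old ψ i)))) , refl
insert-injective {n} φ ψ nothing (just (q , r₁ , r₂)) _ _ _ _ same =
  ⊥-elim (new≢old (cong proj₂ (trans (sym (InsertNew.at-new φ)) (trans (same (fromℕ n)) (InsertAfter.at-new ψ q r₁ r₂)))))
insert-injective {n} φ ψ (just (p , s₁ , s₂)) nothing _ _ _ _ same =
  ⊥-elim (new≢old (cong proj₂ (trans (sym (InsertNew.at-new ψ)) (trans (sym (same (fromℕ n))) (InsertAfter.at-new φ p s₁ s₂)))))
insert-injective {n} φ ψ (just (p , s₁ , s₂)) (just (q , r₁ , r₂)) (φ-inj , φ-nfp) (ψ-inj , ψ-nfp) valid-φ valid-ψ same =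
  agree , cong just (cong₂ _,_ p≡q (cong₂ _,_ s₁≡r₁ s₂≡r₂))
  where
  module A = InsertAfter φ p s₁ s₂
  module B = InsertAfter ψ q r₁ r₂
  -- at n+1 both insertions give (s₂ , π(j)) ...
  at-new : (s₂ , inject₁ (perm φ A.j)) ≡ (r₂ , inject₁ (perm ψ B.j))
  at-new = trans (sym A.at-new) (trans (same (fromℕ n)) B.at-new)
  s₂≡r₂ : s₂ ≡ r₂
  s₂≡r₂ = cong proj₁ at-new
  -- ... and the unique point mapped to n+1 is j
  j≡j : A.j ≡ B.j
  j≡j with A.j Fin.≟ B.j
  ... | yes e = e
  ... | no j≢j = ⊥-elim (new≢old (cong proj₂ (trans (sym A.at-j) (trans (same (inject₁ A.j)) (B.at-old A.j j≢j)))))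
  s₁≡r₁ : s₁ ≡ r₁
  s₁≡r₁ = cong proj₁ (trans (sym A.at-j) (trans (same (inject₁ A.j)) (trans (cong (insert ψ (just (q , r₁ , r₂)) ∘ inject₁) j≡j) B.at-j)))
  perm-at-j : perm φ A.j ≡ perm ψ A.j
  perm-at-j = trans (FinP.inject₁-injective (cong proj₂ at-new)) (cong (perm ψ) (sym j≡j))
  -- the sign at j is forced: by validity, or because j is a negative fixed point
  sign-at-j : negative φ A.j ≡ negative ψ A.j
  sign-at-j = by-cases (perm φ A.j Fin.≟ A.j)
    where
    by-cases : Dec (perm φ A.j ≡ A.j) → negative φ A.j ≡ negative ψ A.j
    by-cases (yes fixed) = trans (fixed⇒negative φ φ-nfp A.j fixed) (sym (fixed⇒negative ψ ψ-nfp A.j (trans (sym perm-at-j) fixed)))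
    by-cases (no moves) = trans (sym (valid-sign φ p s₁ s₂ valid-φ moves))
                                (trans s₂≡r₂ (trans (valid-sign ψ q r₁ r₂ valid-ψ moves')
                                                    (cong (negative ψ) (sym j≡j))))
      where
      moves' : perm ψ B.j ≢ B.j
      moves' e = moves (trans perm-at-j (trans (cong (perm ψ) j≡j) (trans e (sym j≡j))))
  agree : ∀ i → φ i ≡ ψ i
  agree i with i Fin.≟ A.j
  ... | yes refl = cong₂ _,_ sign-at-j perm-at-j
  ... | no i≢j = liftS-injective (trans (sym (A.at-old i i≢j)) (trans (same (inject₁ i)) (B.at-old i (λ e → i≢j (trans e (sym j≡j))))))
  p≡q : p ≡ q
  p≡q = φ-inj p q (trans j≡j (sym (cong proj₂ (agree q))))

injective⇒onto : ∀ {m} (f : Fin m → Fin m) → Injective f → ∀ y → Σ (Fin m) λ x → f x ≡ y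
injective⇒onto {suc m} f inj y with FinP.any? (λ x → f x Fin.≟ y)
... | yes found = found
... | no missed = ⊥-elim (ℕP.<-irrefl refl (FinP.injective⇒≤ squeeze-injective))
  where
  -- f misses y, so it squeezes Fin (suc m) injectively into Fin m
  squeeze : Fin (suc m) → Fin m
  squeeze x = Fin.punchOut {i = y} {j = f x} (λ e → missed (x , sym e))
  squeeze-injective : ∀ {a b} → squeeze a ≡ squeeze b → a ≡ b
  squeeze-injective {a} {b} e =
    inj a b (FinP.punchOut-injective {i = y} (λ e' → missed (a , sym e')) (λ e' → missed (b , sym e')) e)

-- Lowering an old point of Fin (suc n) to Fin n (the default d is never used).
lower : ∀ {n} → Fin (suc n) → Fin n → Fin n
lower y d = Maybe.fromMaybe d (unlast y)

lower-inject : ∀ {n} (y : Fin (suc n)) d → y ≢ fromℕ n → inject₁ (lower y d) ≡ y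
lower-inject y d y≢new with last-view y
... | inj₁ (z , refl) = cong (inject₁ ∘ Maybe.fromMaybe d) (unlast-inject₁ z)
... | inj₂ y≡new = ⊥-elim (y≢new y≡new)

-- Every signed derangement of [n+1] is obtained by insertion: deleting n+1.
module Deletion {n} (φ' : SignedFun (suc n)) (derangement' : IsDerangement φ') where

  Preimage : Set
  Preimage = Σ (SignedFun n × Tag n) λ (φ , t) → IsDerangement φ × validTag φ t ≡ true × (∀ x → insert φ t x ≡ φ' x)

  private
    injective' = proj₁ derangement'
    no-fixed-point' = proj₂ derangement'
    top = fromℕ n

    k = proj₁ (injective⇒onto (perm φ') injective' top)
    k↦top : perm φ' k ≡ top
    k↦top = proj₂ (injective⇒onto (perm φ') injective' top)

    others-stay-old : ∀ x → x ≢ k → perm φ' x ≢ top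
    others-stay-old x x≢k e = x≢k (injective' x k (trans e (sym k↦top)))

    lowered : Fin n → Signed n
    lowered i = negative φ' (inject₁ i) , lower (perm φ' (inject₁ i)) i

    lift-lowered : ∀ i → inject₁ i ≢ k → liftS (lowered i) ≡ φ' (inject₁ i)
    lift-lowered i i≢k = cong (negative φ' (inject₁ i) ,_) (lower-inject _ i (others-stay-old (inject₁ i) i≢k))

  -- n+1 is a fixed point of π': it was inserted as a new cycle.
  module TopFixed (k≡top : k ≡ top) where

    φ : SignedFun n
    φ = lowered

    private
      lift-φ : ∀ i → liftS (φ i) ≡ φ' (inject₁ i)
      lift-φ i = lift-lowered i (λ e → old≢new (trans e k≡top))

      top-fixed : perm φ' top ≡ top
      top-fixed = trans (cong (perm φ') (sym k≡top)) k↦top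

      derangement : IsDerangement φ
      derangement = (λ i i' e → FinP.inject₁-injective (injective' _ _ (trans (sym (cong proj₂ (lift-φ i)))
                                                                         (trans (cong inject₁ e) (cong proj₂ (lift-φ i')))))) ,
                    (λ i positive fixed → no-fixed-point' (inject₁ i) positive (trans (sym (cong proj₂ (lift-φ i))) (cong inject₁ fixed)))

      reinsert : ∀ x → insert φ nothing x ≡ φ' x
      reinsert x with last-view x
      ... | inj₁ (i , refl) = trans (InsertNew.at-old φ i) (lift-φ i)
      ... | inj₂ refl = trans (InsertNew.at-new φ) (cong₂ _,_ (sym (fixed⇒negative φ' no-fixed-point' top top-fixed)) (sym top-fixed))

    preimage : Preimage
    preimage = (φ , nothing) , derangement , refl , reinsert

  -- π'(j) = ±(n+1) for an old point j: n+1 was inserted behind π(p), where |π(p)| = j.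
  module TopAfter (j : Fin n) (k≡j : k ≡ inject₁ j) where

    private
      j↦top : perm φ' (inject₁ j) ≡ top
      j↦top = trans (cong (perm φ') (sym k≡j)) k↦top

      after-top-old : perm φ' top ≢ top
      after-top-old e = new≢old (injective' top (inject₁ j) (trans e (sym j↦top)))

      -- |π(j)| = |π'(n+1)|
      y : Fin n
      y = lower (perm φ' top) j

      -- if j becomes a singleton it must be negative; otherwise π(j) carries the sign of π'(n+1)
      sign-j : Bool
      sign-j = if ⌊ y Fin.≟ j ⌋ then true else negative φ' top

      sign-j-singleton : y ≡ j → sign-j ≡ true
      sign-j-singleton y≡j = cong (λ b → if b then true else negative φ' top) (⌊⌋-true (y Fin.≟ j) y≡j)

      sign-j-moves : y ≢ j → sign-j ≡ negative φ' top
      sign-j-moves y≢j = cong (λ b → if b then true else negative φ' top) (⌊⌋-false (y Fin.≟ j) y≢j)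

    φ : SignedFun n
    φ i = if ⌊ i Fin.≟ j ⌋ then (sign-j , y) else lowered i

    private
      φ-j : φ j ≡ (sign-j , y)
      φ-j = cong (λ b → if b then (sign-j , y) else lowered j) (⌊⌋-true (j Fin.≟ j) refl)

      φ-old : ∀ i → i ≢ j → φ i ≡ lowered i
      φ-old i i≢j = cong (λ b → if b then (sign-j , y) else lowered i) (⌊⌋-false (i Fin.≟ j) i≢j)

      lift-old : ∀ i → i ≢ j → liftS (φ i) ≡ φ' (inject₁ i)
      lift-old i i≢j = trans (cong liftS (φ-old i i≢j)) (lift-lowered i (λ e → i≢j (FinP.inject₁-injective (trans e k≡j))))

      perm-old : ∀ i → i ≢ j → inject₁ (perm φ i) ≡ perm φ' (inject₁ i)
      perm-old i i≢j = cong proj₂ (lift-old i i≢j)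

      perm-j : inject₁ (perm φ j) ≡ perm φ' top
      perm-j = trans (cong (inject₁ ∘ proj₂) φ-j) (lower-inject _ j after-top-old)

      injective : Injective (perm φ)
      injective i i' e = by-cases (i Fin.≟ j) (i' Fin.≟ j)
        where
        by-cases : Dec (i ≡ j) → Dec (i' ≡ j) → i ≡ i'
        by-cases (yes i≡j) (yes i'≡j) = trans i≡j (sym i'≡j)
        by-cases (no i≢j) (no i'≢j) =
          FinP.inject₁-injective (injective' _ _ (trans (sym (perm-old i i≢j)) (trans (cong inject₁ e) (perm-old i' i'≢j))))
        by-cases (yes refl) (no i'≢j) =
          ⊥-elim (new≢old (injective' _ _ (trans (sym perm-j) (trans (cong inject₁ e) (perm-old i' i'≢j)))))
        by-cases (no i≢j) (yes refl) =
          ⊥-elim (new≢old (injective' _ _ (trans (sym perm-j) (trans (cong inject₁ (sym e)) (perm-old i i≢j)))))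

      no-fixed-point : NoFixedPoint φ
      no-fixed-point i positive fixed = by-cases (i Fin.≟ j)
        where
        by-cases : Dec (i ≡ j) → ⊥
        by-cases (yes refl) with () ← trans (sym (sign-j-singleton (trans (sym (cong proj₂ φ-j)) fixed)))
                                            (trans (sym (cong proj₁ φ-j)) positive)
        by-cases (no i≢j) = no-fixed-point' (inject₁ i) (trans (sym (cong proj₁ (lift-old i i≢j))) positive)
                                            (trans (sym (perm-old i i≢j)) (cong inject₁ fixed))

      p = proj₁ (injective⇒onto (perm φ) injective j)
      p↦j : perm φ p ≡ j
      p↦j = proj₂ (injective⇒onto (perm φ) injective j)

    tag : Tag n
    tag = just (p , negative φ' (inject₁ j) , negative φ' top)

    private
      module A = InsertAfter φ p (negative φ' (inject₁ j)) (negative φ' top)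

      valid-at-j : (⌊ negative φ' top Bool.≟ negative φ j ⌋ ∨ ⌊ perm φ j Fin.≟ j ⌋) ≡ true
      valid-at-j = by-cases (y Fin.≟ j)
        where
        by-cases : Dec (y ≡ j) → (⌊ negative φ' top Bool.≟ negative φ j ⌋ ∨ ⌊ perm φ j Fin.≟ j ⌋) ≡ true
        by-cases (yes y≡j) = trans (cong (⌊ negative φ' top Bool.≟ negative φ j ⌋ ∨_) (⌊⌋-true (perm φ j Fin.≟ j) (trans (cong proj₂ φ-j) y≡j)))
                                   (∨-zeroʳ _)
        by-cases (no y≢j) = cong (_∨ ⌊ perm φ j Fin.≟ j ⌋)
                                 (⌊⌋-true (negative φ' top Bool.≟ negative φ j) (sym (trans (cong proj₁ φ-j) (sign-j-moves y≢j))))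

      valid : validTag φ tag ≡ true
      valid = subst (λ z → (⌊ negative φ' top Bool.≟ negative φ z ⌋ ∨ ⌊ perm φ z Fin.≟ z ⌋) ≡ true) (sym p↦j) valid-at-j

      reinsert : ∀ x → insert φ tag x ≡ φ' x
      reinsert x with last-view x
      ... | inj₂ refl = trans A.at-new (cong (negative φ' top ,_) (trans (cong (inject₁ ∘ perm φ) p↦j) perm-j))
      ... | inj₁ (i , refl) with i Fin.≟ j
      ... | yes refl = trans (cong (insert φ tag ∘ inject₁) (sym p↦j)) (trans A.at-j (cong (negative φ' (inject₁ i) ,_) (sym j↦top)))
      ... | no i≢j = trans (A.at-old i (λ e → i≢j (trans e p↦j))) (lift-old i i≢j)

    preimage : Preimage
    preimage = (φ , tag) , (injective , no-fixed-point) , valid , reinsert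

  preimage : Preimage
  preimage with last-view k
  ... | inj₁ (j , k≡j) = TopAfter.preimage j k≡j
  ... | inj₂ k≡top = TopFixed.preimage k≡top

pairs : List (Bool × Bool)
pairs = cartesianProduct bools bools

tags : ∀ n → List (Tag n)
tags n = nothing ∷ map just (cartesianProduct (allFin n) pairs)

module InsertionSum {n} (φ : SignedFun n) (derangement : IsDerangement φ) (G : Stats → ℕ) where

  private
    w = wexcF φ
    a = aexcF φ
    s = singleF φ
    c = cycF φ
    G-new = G (w , a , suc s , suc c)
    G-ascent = G (w , suc a , s , c)
    G-descent = G (suc w , a , s , c)
    G-singleton = G (suc w , suc a , pred s , c)

  weight : Tag n → ℕ
  weight t = 𝟙 (validTag φ t) * G (statsF (insert φ t))

  behind : Fin n → ℕ
  behind p = ∑ pairs (λ (s₁ , s₂) → weight (just (p , s₁ , s₂)))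

  contribution : Bool → Bool → Bool → ℕ
  contribution asc desc single = 𝟙 asc * (2 * G-ascent) + (𝟙 desc * (2 * G-descent) + 𝟙 single * (4 * G-singleton))

  behind-value : Fin n → ℕ
  behind-value p = contribution (ascentAt φ p) (descentAt φ p) (singleAt φ p)

  private
    valid-behind : Fin n → Bool × Bool → Bool
    valid-behind p (s₁ , s₂) = validTag φ (just (p , s₁ , s₂))

  -- Behind a singleton (−p) all four sign choices are valid and give G-singleton.
  behind-singleton : ∀ p → perm φ p ≡ p → behind p ≡ behind-value p
  behind-singleton p p-fixed = begin
    behind p
      ≡⟨ ∑-const-on pairs (valid-behind p) _ G-singleton
                    (λ (s₁ , s₂) _ → cong G (StatsAfter.Singleton.statsF-singleton φ derangement p s₁ s₂ p-fixed)) ⟩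
    ∑ pairs (𝟙 ∘ valid-behind p) * G-singleton
      ≡⟨ cong (_* G-singleton) (∑-cong pairs all-valid) ⟩
    4 * G-singleton
      ≡⟨ sym (only-single no-ascent no-descent single-at-p) ⟩
    behind-value p ∎
    where
    open ≡-Reasoning
    all-valid : ∀ pair → 𝟙 (valid-behind p pair) ≡ 1
    all-valid (s₁ , s₂) =
      cong 𝟙 (trans (cong (λ b → ⌊ s₂ Bool.≟ negative φ (perm φ p) ⌋ ∨ b) (⌊⌋-true (_ Fin.≟ _) (cong (perm φ) p-fixed)))
                    (∨-zeroʳ _))
    no-ascent : ascentAt φ p ≡ false
    no-ascent = trans (cong (φ p ≺_) (cong φ p-fixed)) (≺-irrefl (φ p))
    no-descent : descentAt φ p ≡ false
    no-descent = trans (cong (_≺ φ p) (cong φ p-fixed)) (≺-irrefl (φ p))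
    single-at-p : singleAt φ p ≡ true
    single-at-p = cong₂ _∧_ (fixed⇒negative φ (proj₂ derangement) p p-fixed) (⌊⌋-true (perm φ p Fin.≟ p) p-fixed)
    only-single : ∀ {x y z} → x ≡ false → y ≡ false → z ≡ true → contribution x y z ≡ 4 * G-singleton
    only-single refl refl refl = ℕP.+-identityʳ _

  -- Behind a point of a longer cycle s₂ is forced and s₁ is free; the effect
  -- depends on whether the pair π(p), π(|π(p)|) ascends or descends.
  module Moving (p : Fin n) (moves : perm φ p ≢ p) where

    private
      j = perm φ p

      j-moves : perm φ j ≢ j
      j-moves e = moves (proj₁ derangement j p e)

      two-valid : ∑ pairs (𝟙 ∘ valid-behind p) ≡ 2
      two-valid =
        trans (∑-cartesian bools bools (𝟙 ∘ valid-behind p))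
              (∑-cong bools (λ s₁ → trans (∑-cong bools (λ s₂ → cong 𝟙 (trans (cong (⌊ s₂ Bool.≟ negative φ j ⌋ ∨_)
                                                                                       (⌊⌋-false (perm φ j Fin.≟ j) j-moves))
                                                                                (∨-identityʳ _))))
                                          (exact-bools (negative φ j))))

      no-single : singleAt φ p ≡ false
      no-single = trans (cong (negative φ p ∧_) (⌊⌋-false (j Fin.≟ p) moves)) (∧-zeroʳ _)

      ascent-or-descent : 𝟙 (ascentAt φ p) + 𝟙 (descentAt φ p) ≡ 1
      ascent-or-descent = ≺-exactly-one (φ p) (φ j) (λ e → j-moves (sym e))

    behind-moving : behind p ≡ behind-value p
    behind-moving with ascentAt φ p in ascent | descentAt φ p in descent | ascent-or-descent
    ... | true | true | ()
    ... | false | false | ()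
    ... | true | false | _ = begin
      behind p
        ≡⟨ ∑-const-on pairs (valid-behind p) _ G-ascent
             (λ (s₁ , s₂) valid → cong G (StatsAfter.NonSingleton.statsF-ascent φ derangement p s₁ s₂ valid (moves ∘ sym) ascent)) ⟩
      ∑ pairs (𝟙 ∘ valid-behind p) * G-ascent
        ≡⟨ cong (_* G-ascent) two-valid ⟩
      2 * G-ascent
        ≡⟨ sym (only-ascent no-single) ⟩
      contribution true false (singleAt φ p) ∎
      where
      open ≡-Reasoning
      only-ascent : ∀ {z} → z ≡ false → contribution true false z ≡ 2 * G-ascent
      only-ascent refl = trans (ℕP.+-identityʳ _) (ℕP.+-identityʳ _)
    ... | false | true | _ = begin
      behind p
        ≡⟨ ∑-const-on pairs (valid-behind p) _ G-descent
             (λ (s₁ , s₂) valid → cong G (StatsAfter.NonSingleton.statsF-descent φ derangement p s₁ s₂ valid (moves ∘ sym) ascent)) ⟩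
      ∑ pairs (𝟙 ∘ valid-behind p) * G-descent
        ≡⟨ cong (_* G-descent) two-valid ⟩
      2 * G-descent
        ≡⟨ sym (only-descent no-single) ⟩
      contribution false true (singleAt φ p) ∎
      where
      open ≡-Reasoning
      only-descent : ∀ {z} → z ≡ false → contribution false true z ≡ 2 * G-descent
      only-descent refl = trans (ℕP.+-identityʳ _) (ℕP.+-identityʳ _)

  insertion-sum : ∑ (tags n) weight ≡ Step G (statsF φ)
  insertion-sum = begin
    ∑ (tags n) weight
      ≡⟨ cong (_+_ (weight nothing)) (trans (∑-map just (cartesianProduct (allFin n) pairs) weight) (∑-cartesian (allFin n) pairs (weight ∘ just))) ⟩
    weight nothing + ∑ (allFin n) behind
      ≡⟨ cong₂ _+_ new-cycle (∑-cong (allFin n) behind-correct) ⟩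
    G-new + ∑ (allFin n) behind-value
      ≡⟨ cong (_+_ (G-new)) sum-of-contributions ⟩
    G-new + (w * (2 * G-ascent) + (a * (2 * G-descent) + s * (4 * G-singleton)))
      ≡⟨ rearrange w a s G-ascent G-descent G-singleton G-new ⟩
    Step G (statsF φ) ∎
    where
    open ≡-Reasoning
    new-cycle : weight nothing ≡ G-new
    new-cycle = trans (ℕP.+-identityʳ _) (cong G (StatsNew.statsF-new φ derangement))
    behind-correct : ∀ p → behind p ≡ behind-value p
    behind-correct p = by-cases (perm φ p Fin.≟ p)
      where
      by-cases : Dec (perm φ p ≡ p) → behind p ≡ behind-value p
      by-cases (yes p-fixed) = behind-singleton p p-fixed
      by-cases (no moves) = Moving.behind-moving p moves
    sum-of-contributions : ∑ (allFin n) behind-value ≡ w * (2 * G-ascent) + (a * (2 * G-descent) + s * (4 * G-singleton))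
    sum-of-contributions =
      trans (∑-+ (allFin n) _ _)
            (cong₂ _+_ (∑-*ʳ (allFin n) _ _) (trans (∑-+ (allFin n) _ _) (cong₂ _+_ (∑-*ʳ (allFin n) _ _) (∑-*ʳ (allFin n) _ _))))
    rearrange : ∀ w a s x y z u → u + (w * (2 * x) + (a * (2 * y) + s * (4 * z))) ≡ 2 * w * x + (2 * a * y + (4 * s * z + u))
    rearrange = solve-∀

extend : ∀ {n} → SFun n → Tag n → SFun (suc n)
extend π t = Vec.tabulate (insert (lookup π) t)

lookup-extend : ∀ {n} (π : SFun n) t x → lookup (extend π t) x ≡ insert (lookup π) t x
lookup-extend π t = VecP.lookup∘tabulate (insert (lookup π) t)

stats-extend : ∀ {n} (π : SFun n) t → stats (extend π t) ≡ statsF (insert (lookup π) t)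
stats-extend π t = trans (stats-lookup (extend π t)) (statsF-cong (lookup-extend π t))

vec-ext : ∀ {n} {A : Set} (u v : Vec A n) → (∀ i → lookup u i ≡ lookup v i) → u ≡ v
vec-ext u v e = trans (sym (VecP.tabulate∘lookup u)) (trans (VecP.tabulate-cong e) (VecP.tabulate∘lookup v))

signedFuns : ∀ n → List (SFun n)
signedFuns n = allVecs n (cartesianProduct bools (allFin n))

_≟S_ : ∀ {n} → DecidableEquality (SFun n)
_≟S_ = VecP.≡-dec (ProdP.≡-dec Bool._≟_ Fin._≟_)

_≟T_ : ∀ {n} → DecidableEquality (Tag n)
_≟T_ = MaybeP.≡-dec (ProdP.≡-dec Fin._≟_ (ProdP.≡-dec Bool._≟_ Bool._≟_))

exact-signedFuns : ∀ n → Exact _≟S_ (signedFuns n)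
exact-signedFuns n =
  exact-allVecs _ (cartesianProduct bools (allFin n)) (exact-× Bool._≟_ Fin._≟_ bools (allFin n) exact-bools (exact-allFin n)) n

exact-tags : ∀ n → Exact _≟T_ (tags n)
exact-tags n =
  exact-maybe _ (cartesianProduct (allFin n) pairs)
    (exact-× Fin._≟_ _ (allFin n) pairs (exact-allFin n) (exact-× Bool._≟_ Bool._≟_ bools bools exact-bools exact-bools))

admissible : ∀ {n} → SFun n × Tag n → Bool
admissible (π , t) = isDerangement π ∧ validTag (lookup π) t

module _ {n : ℕ} where

  extend-derangement : ∀ (x : SFun n × Tag n) → admissible x ≡ true → isDerangement (extend (proj₁ x) (proj₂ x)) ≡ true
  extend-derangement (π , t) adm =
    isDerangement-complete (extend π t)
      (IsDerangement-cong (sym ∘ lookup-extend π t) (insert-derangement (lookup π) (isDerangement-sound π (proj₁ (∧-true {isDerangement π} adm))) t))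

  extend-injective : ∀ (x y : SFun n × Tag n) → admissible x ≡ true → admissible y ≡ true →
    extend (proj₁ x) (proj₂ x) ≡ extend (proj₁ y) (proj₂ y) → x ≡ y
  extend-injective (π , t) (ρ , u) adm-x adm-y e
    with insert-injective (lookup π) (lookup ρ) t u (isDerangement-sound π (proj₁ (∧-true {isDerangement π} adm-x))) (isDerangement-sound ρ (proj₁ (∧-true {isDerangement ρ} adm-y)))
                          (proj₂ (∧-true {isDerangement π} adm-x)) (proj₂ (∧-true {isDerangement ρ} adm-y))
                          (λ x → trans (sym (lookup-extend π t x)) (trans (cong (λ v → lookup v x) e) (lookup-extend ρ u x)))
  ... | π≗ρ , refl = cong (_, t) (vec-ext π ρ π≗ρ)

  extend-onto : ∀ π' → isDerangement {suc n} π' ≡ true → Σ (SFun n × Tag n) λ x → admissible x ≡ true × extend (proj₁ x) (proj₂ x) ≡ π'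
  extend-onto π' der with Deletion.preimage (lookup π') (isDerangement-sound π' der)
  ... | (φ , t) , derangement , valid , reinsert =
    (π , t) ,
    cong₂ _∧_ (isDerangement-complete π (IsDerangement-cong (sym ∘ lookup-π) derangement))
              (trans (validTag-cong lookup-π t) valid) ,
    vec-ext _ _ (λ x → trans (lookup-extend π t x) (trans (insert-cong lookup-π t x) (reinsert x)))
    where
    π : SFun n
    π = Vec.tabulate φ
    lookup-π : ∀ i → lookup π i ≡ φ i
    lookup-π = VecP.lookup∘tabulate φ

recurrence : ∀ n (G : Stats → ℕ) → ∑ (derangementsB (suc n)) (G ∘ stats) ≡ ∑ (derangementsB n) (Step G ∘ stats)
recurrence n G = begin
  ∑ (derangementsB (suc n)) (G ∘ stats)
    ≡⟨ ∑-filter isDerangement (signedFuns (suc n)) (G ∘ stats) ⟩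
  ∑ (signedFuns (suc n)) (λ π' → 𝟙 (isDerangement π') * G (stats π'))
    ≡⟨ reindex (ProdP.≡-dec _≟S_ _≟T_) _≟S_ candidates (signedFuns (suc n))
               (exact-× _≟S_ _≟T_ (signedFuns n) (tags n) (exact-signedFuns n) (exact-tags n)) (exact-signedFuns (suc n))
               admissible isDerangement (λ (π , t) → extend π t) extend-derangement extend-injective extend-onto (G ∘ stats) ⟩
  ∑ candidates (λ (π , t) → 𝟙 (admissible (π , t)) * G (stats (extend π t)))
    ≡⟨ ∑-cartesian (signedFuns n) (tags n) _ ⟩
  ∑ (signedFuns n) (λ π → ∑ (tags n) (λ t → 𝟙 (admissible (π , t)) * G (stats (extend π t))))
    ≡⟨ ∑-cong (signedFuns n) insertions ⟩
  ∑ (signedFuns n) (λ π → 𝟙 (isDerangement π) * Step G (stats π))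
    ≡⟨ sym (∑-filter isDerangement (signedFuns n) (Step G ∘ stats)) ⟩
  ∑ (derangementsB n) (Step G ∘ stats) ∎
  where
  open ≡-Reasoning
  candidates = cartesianProduct (signedFuns n) (tags n)
  insertions : ∀ π → ∑ (tags n) (λ t → 𝟙 (admissible (π , t)) * G (stats (extend π t))) ≡ 𝟙 (isDerangement π) * Step G (stats π)
  insertions π with isDerangement π in der
  ... | false = ∑-zero (tags n)
  ... | true =
    trans (∑-cong (tags n) (λ t → cong (λ v → 𝟙 (validTag (lookup π) t) * G v) (stats-extend π t)))
    (trans (InsertionSum.insertion-sum (lookup π) (isDerangement-sound π der) G)
    (trans (cong (Step G) (sym (stats-lookup π))) (sym (ℕP.+-identityʳ _))))

mainTheorem10 : (n : ℕ) → (m : Mono) → coeff m (Dⁿ n ePoly) ≡ coeff m (rhs n)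
mainTheorem10 zero m = refl
mainTheorem10 (suc n) m = begin
  coeff m (D (Dⁿ n ePoly))
    ≡⟨ D-respects-coeff (Dⁿ n ePoly) (rhs n) (mainTheorem10 n) m ⟩
  coeff m (D (rhs n))
    ≡⟨ coeff-D-units (derangementsB n) (statMono ∘ stats) m (Step (hits m) ∘ stats) (λ π → coeff-D-statMono (stats π) m) ⟩
  + ∑ (derangementsB n) (Step (hits m) ∘ stats)
    ≡⟨ cong +_ (sym (recurrence n (hits m))) ⟩
  + ∑ (derangementsB (suc n)) (hits m ∘ stats)
    ≡⟨ sym (coeff-units (derangementsB (suc n)) (statMono ∘ stats) m) ⟩
  coeff m (rhs (suc n)) ∎
  where open ≡-Reasoning
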